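{- Let $R$ be a ring, $\tau\in\mathbf{M}_{\mathrm{stab}}(R)$ and $a\in\mathbf{G}_\tau(R)$ (so $1\in\mathbf{X}_{\tau,a}(R)$). The following are equivalent: (i) $\mathbf{X}_{\tau,a}$ is tangential at $1$ over $R$; (ii) $\mu=\nu$, where $\mu,\nu:\mathbf{M}_{H,\tau_H}(R)\to\mathbf{M}_\tau(R)$ are $\mu(u)=[e^*\bullet]^{ -1}(e^*aua^{ -1})$ and $\nu(u)=[\bullet e]^{ -1}(aua^{ -1}e)$; (iii) for every $j\geq0$, with $A_j:=e^*a\tau^je\in R$ and $B_j:=e^*a^{ -1}\tau^je\in R$, one has $A_ja^{ -1}=B_ja$ in $\mathbf{M}(R)$; (iv) $a^2\in\mathbf{Z}(R)$.
   Context: Rings are commutative with $1$. Let $\mathbf{V}$ be a free $\mathbb{Z}$-module of finite rank, $\mathbf{V}^*=\mathrm{Hom}(\mathbf{V},\mathbb{Z})$; fix $e\in\mathbf{V}$, $e^*\in\mathbf{V}^*$ with $e^*(e)=1$. For a ring $R$: $\mathbf{V}(R)=\mathbf{V}\otimes R$, $\mathbf{V}^*(R)=\mathrm{Hom}_R(\mathbf{V}(R),R)$, $\mathbf{M}(R)=\mathrm{End}_R(\mathbf{V}(R))$, $\mathbf{G}(R)=\mathrm{Aut}_R(\mathbf{V}(R))$, $\mathbf{Z}(R)=R^\times$ (scalars). Juxtaposition: $\ell v=\ell(v)$, $xv=x(v)$, $\ell x=\ell\circ x$, $v\ell=(u\mapsto\ell(u)v)$. $\mathbf{V}_H(R)=\{v:e^*v=0\}$,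 $1_H=1-ee^*$, $\mathbf{M}_H(R)=\mathrm{End}_R(\mathbf{V}_H(R))$, viewed inside $\mathbf{M}(R)$ by extending by $0$ on $Re$; $\mathbf{H}(R)=\mathrm{Aut}_R(\mathbf{V}_H(R))$ acting trivially on $Re$; $\tau_H=1_H\tau1_H$. For an $R$-algebra $R'$: $\mathbf{G}_\tau(R')$, $\mathbf{M}_\tau(R')$ are the centralizers of $\tau$ in $\mathbf{G}(R')$, $\mathbf{M}(R')$; for $\sigma\in\mathbf{M}_H(R)$, $\mathbf{H}_\sigma(R')$, $\mathbf{M}_{H,\sigma}(R')$ are the centralizers of $\sigma$ in $\mathbf{H}(R')$, $\mathbf{M}_H(R')$. $v$ (resp. $\ell$) is $\tau$-cyclic if $R[\tau]v=\mathbf{V}(R)$ (resp. $\ell R[\tau]=\mathbf{V}^*(R)$); $\tau$ is stable if $e$ and $e^*$ are $\tau$-cyclic; $\mathbf{M}_{\mathrm{stab}}(R)$ = stable elements. For $\tau$ stable, the maps $\mathbf{M}_\tau(R)\to\mathbf{V}(R)$, $x\mapsto xe$, and $\mathbf{M}_\tau(R)\to\mathbf{V}^*(R)$, $x\mapsto e^*x$, are $R$-linear bijections; $[\bullet e]^{ -1}$ and $[e^*\bullet]^{ -1}$ denote their inverses. For $a\in\mathbf{G}(R)$: $\mathbf{X}_{\tau,a}(R')=\{y\in\mathbf{H}_{\tau_H}(R'):ay\in\mathbf{H}(R')\mathbf{G}_\tau(R')\}$. With $R'=R[\varepsilon]/(\varepsilon^2)$, $\mathbf{X}_{\tau,a}$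 is tangential at $y\in\mathbf{X}_{\tau,a}(R)$ over $R$ if every $y'\in\mathbf{H}_{\tau_H}(R')$ reducing to $y$ modulo $\varepsilon$ lies in $\mathbf{X}_{\tau,a}(R')$. -}

module Defs where

open import Level using (Level; _⊔_)
open import Data.Nat using (ℕ; zero; suc)
open import Data.Fin using (Fin; zero; suc)
open import Data.Integer as ℤ using (ℤ; +_; -[1+_])
open import Data.Product using (Σ; _×_; _,_; ∃; proj₁; proj₂)
open import Data.List using (List; []; _∷_)
open import Relation.Nullary using (yes; no)
open import Algebra.Bundles using (CommutativeRing)
open import Algebra.Bundles.Raw using (RawRing)

sumℤ : ∀ {n} → (Fin n → ℤ) → ℤ
sumℤ {zero}  f = + 0
sumℤ {suc n} f = f zero ℤ.+ sumℤ (λ i → f (suc i))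

-- Dual numbers R[ε]/(ε²) as a raw ring: (a , b) stands for a + bε.

Dual : ∀ {c ℓ} → RawRing c ℓ → RawRing c ℓ
Dual R = record
  { Carrier = Carrier × Carrier
  ; _≈_     = λ x y → (proj₁ x ≈ proj₁ y) × (proj₂ x ≈ proj₂ y)
  ; _+_     = λ x y → (proj₁ x + proj₁ y , proj₂ x + proj₂ y)
  ; _*_     = λ x y → (proj₁ x * proj₁ y , proj₁ x * proj₂ y + proj₂ x * proj₁ y)
  ; -_      = λ x → (- proj₁ x , - proj₂ x)
  ; 0#      = (0# , 0#)
  ; 1#      = (1# , 0#)
  }
  where open RawRing R

-- Linear algebra on V(R) = R^n (V = ℤ^n with its standard basis),
-- with fixed e ∈ V, e* ∈ V* given by integer coordinates.

module Lin {c ℓ} (R : RawRing c ℓ) (n : ℕ) (e e* : Fin n → ℤ) where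
  open RawRing R

  fromℕ : ℕ → Carrier
  fromℕ zero    = 0#
  fromℕ (suc k) = 1# + fromℕ k

  fromℤ : ℤ → Carrier
  fromℤ (+ k)      = fromℕ k
  fromℤ -[1+ k ]   = - fromℕ (suc k)

  Σ[_] : ∀ {m} → (Fin m → Carrier) → Carrier
  Σ[_] {zero}  f = 0#
  Σ[_] {suc m} f = f zero + Σ[ (λ i → f (suc i)) ]

  Vec : Set c
  Vec = Fin n → Carrier

  CoVec : Set c
  CoVec = Fin n → Carrier

  Mat : Set c
  Mat = Fin n → Fin n → Carrier

  _≈ᵥ_ : Vec → Vec → Set ℓ
  v ≈ᵥ w = ∀ i → v i ≈ w i

  _≈ₘ_ : Mat → Mat → Set ℓ
  x ≈ₘ y = ∀ i j → x i j ≈ y i j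

  _⊗_ : Mat → Mat → Mat
  (x ⊗ y) i j = Σ[ (λ k → x i k * y k j) ]

  _·ᵥ_ : Mat → Vec → Vec
  (x ·ᵥ v) i = Σ[ (λ k → x i k * v k) ]

  _ᵥ·_ : CoVec → Mat → CoVec
  (l ᵥ· x) j = Σ[ (λ k → l k * x k j) ]

  ⟨_,_⟩ : CoVec → Vec → Carrier
  ⟨ l , v ⟩ = Σ[ (λ k → l k * v k) ]

  outer : Vec → CoVec → Mat
  outer v l i j = v i * l j

  _∙ₘ_ : Carrier → Mat → Mat
  (r ∙ₘ x) i j = r * x i j

  _-ₘ_ : Mat → Mat → Mat
  (x -ₘ y) i j = x i j + (- y i j)

  _+ₘ_ : Mat → Mat → Mat
  (x +ₘ y) i j = x i j + y i j

  idM : Mat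
  idM i j with Data.Fin._≟_ i j
  ... | yes _ = 1#
  ... | no  _ = 0#

  0ₘ : Mat
  0ₘ i j = 0#

  0ᵥ : Vec
  0ᵥ i = 0#

  _^_ : Mat → ℕ → Mat
  x ^ zero  = idM
  x ^ suc k = x ⊗ (x ^ k)

  -- p(x) for a polynomial p given by its coefficient list (constant term first)
  poly : List Carrier → Mat → Mat
  poly []       x = 0ₘ
  poly (r ∷ cs) x = (r ∙ₘ idM) +ₘ (x ⊗ poly cs x)

  eR : Vec
  eR i = fromℤ (e i)

  e*R : CoVec
  e*R i = fromℤ (e* i)

  1H : Mat
  1H = idM -ₘ outer eR e*R

  _H : Mat → Mat
  τ H = 1H ⊗ (τ ⊗ 1H)

  InVH : Vec → Set ℓ
  InVH v = ⟨ e*R , v ⟩ ≈ 0#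

  Commute : Mat → Mat → Set ℓ
  Commute x y = (x ⊗ y) ≈ₘ (y ⊗ x)

  IsInv : Mat → Mat → Set ℓ
  IsInv y y⁻¹ = ((y ⊗ y⁻¹) ≈ₘ idM) × ((y⁻¹ ⊗ y) ≈ₘ idM)

  InH : Mat → Set (c ⊔ ℓ)
  InH g = ((g ·ᵥ eR) ≈ᵥ eR) × (∀ v → InVH v → InVH (g ·ᵥ v))

  -- element of M(R) lying in M_H(R): endomorphism of V_H extended by 0 on Re
  InMH : Mat → Set (c ⊔ ℓ)
  InMH u = ((u ·ᵥ eR) ≈ᵥ 0ᵥ) × (∀ v → InVH v → InVH (u ·ᵥ v))

  CyclicV : Mat → Vec → Set (c ⊔ ℓ)
  CyclicV τ v = ∀ w → ∃ λ (p : List Carrier) → (poly p τ ·ᵥ v) ≈ᵥ w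

  CyclicCo : Mat → CoVec → Set (c ⊔ ℓ)
  CyclicCo τ l = ∀ m → ∃ λ (p : List Carrier) → (l ᵥ· poly p τ) ≈ᵥ m

  Stable : Mat → Set (c ⊔ ℓ)
  Stable τ = CyclicV τ eR × CyclicCo τ e*R

  InHτH : Mat → Mat → Mat → Set (c ⊔ ℓ)
  InHτH τ y y⁻¹ = IsInv y y⁻¹ × InH y × Commute y (τ H)

  InX : Mat → Mat → Mat → Mat → Set (c ⊔ ℓ)
  InX τ a y y⁻¹ = InHτH τ y y⁻¹ ×
    ∃ λ h → ∃ λ h⁻¹ → ∃ λ g → ∃ λ g⁻¹ →
      (IsInv h h⁻¹ × InH h) × (IsInv g g⁻¹ × Commute g τ) × ((a ⊗ y) ≈ₘ (h ⊗ g))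

  -- "x = [e*•]⁻¹(l)": x ∈ M_τ(R) and e* x = l
  IsInvCo : Mat → Mat → CoVec → Set ℓ
  IsInvCo τ x l = Commute x τ × ((e*R ᵥ· x) ≈ᵥ l)

  -- "x = [•e]⁻¹(v)": x ∈ M_τ(R) and x e = v
  IsInvV : Mat → Mat → Vec → Set ℓ
  IsInvV τ x v = Commute x τ × ((x ·ᵥ eR) ≈ᵥ v)

module Setup {c ℓ} (R : CommutativeRing c ℓ) (n : ℕ) (e e* : Fin n → ℤ) where
  open CommutativeRing R using (rawRing; Carrier; _≈_; _*_; 1#)
  module L = Lin rawRing n e e*
  module D = Lin (Dual rawRing) n e e*

  Mat : Set c
  Mat = L.Mat

  base : L.Mat → D.Mat
  base x i j = (x i j , CommutativeRing.0# R)

  red : D.Mat → L.Mat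
  red y i j = proj₁ (y i j)

  Tangential1 : Mat → Mat → Set (c ⊔ ℓ)
  Tangential1 τ a = ∀ (y y⁻¹ : D.Mat) → D.InHτH (base τ) y y⁻¹ →
    (red y L.≈ₘ L.idM) → D.InX (base τ) (base a) y y⁻¹

  μ≡ν : Mat → Mat → Mat → Set (c ⊔ ℓ)
  μ≡ν τ a a⁻¹ = ∀ u → L.InMH u → L.Commute u (τ L.H) →
    ∀ x x' →
    L.IsInvCo τ x (L.e*R L.ᵥ· (a L.⊗ (u L.⊗ a⁻¹))) →
    L.IsInvV τ x' ((a L.⊗ (u L.⊗ a⁻¹)) L.·ᵥ L.eR) →
    x L.≈ₘ x'

  AB : Mat → Mat → Mat → Set ℓ
  AB τ a a⁻¹ = ∀ (j : ℕ) →
    let Aj = L.⟨ L.e*R , (a L.⊗ (τ L.^ j)) L.·ᵥ L.eR ⟩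
        Bj = L.⟨ L.e*R , (a⁻¹ L.⊗ (τ L.^ j)) L.·ᵥ L.eR ⟩
    in (Aj L.∙ₘ a⁻¹) L.≈ₘ (Bj L.∙ₘ a)

  -- (iv) a² ∈ Z(R) = R^× (scalars)
  SqCentral : Mat → Set (c ⊔ ℓ)
  SqCentral a = ∃ λ (r : Carrier) → (∃ λ s → (r * s) ≈ 1#) × ((a L.⊗ a) L.≈ₘ (r L.∙ₘ L.idM))

{-# OPTIONS --safe #-}
-- A tangent vector at 1 is y = 1 + εu with u ∈ M_{H,τ_H}, and a y = h g with h ∈ H, g ∈ G_τ forces
-- h = 1 + εh₁ and g = a + εg₁, i.e. a u a⁻¹ = g₁a⁻¹ + h₁ ∈ M_τ + M_H. Since an element of M_τ = R[τ]
-- is determined by its value on e and also by its pullback of e*, this says exactly μ(u) = ν(u), and,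
-- M_τ being commutative, that w = a u a⁻¹ is balanced: e* X w e = e* w X e for all X ∈ M_τ.
--
-- For K ∈ M_{H,τ_H} the form Φ_K(X, Y) = e* X K Y e is symmetric on M_τ: writing 1 = 1_H + e e*
-- gives τK − Kτ = e e*τK − Kτe e*, which reduces symmetry for K to symmetry for τ_H K. Balance of
-- a K a⁻¹ reads Φ_K(aX, a⁻¹) = Φ_K(a⁻¹X, a). Used for K and τ_H K, and for K = 1_H, it shows that the
-- defect A_j a⁻¹ − B_j a is killed by e* and by every e*τK; these covectors separate M_τ, giving (iii).
-- Evaluating (iii) at the P ∈ R[τ] with P e = a⁻¹e gives a⁻¹ = b a, so a² is a unit scalar; conversely
-- a⁻¹ = s a turns balance into the symmetry of Φ.

module Submission where

open import Defs
open import Data.Nat using (ℕ)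
open import Data.Fin using (Fin)
open import Data.Integer as ℤ using (ℤ; +_)
open import Data.Product using (_×_)
open import Function.Bundles using (_⇔_)
open import Relation.Binary.PropositionalEquality using (_≡_)
open import Algebra.Bundles using (CommutativeRing)

open import Level using (_⊔_)
open import Data.Nat as ℕ using (zero; suc)
open import Data.Fin using (zero; suc)
open import Data.Product using (_,_; proj₁; proj₂; ∃)
open import Data.List using ([]; _∷_)
open import Data.Empty using (⊥-elim)
open import Data.Sign as Sign using (Sign)
open import Function using (_∘_)
open import Function.Bundles using (mk⇔)
open import Relation.Nullary using (yes; no; ¬_)
open import Relation.Binary.Bundles using (Setoid)
import Relation.Binary.PropositionalEquality as P
import Relation.Binary.Reasoning.Setoid as SetoidReasoning
import Data.Integer.Properties as ℤProperties
import Data.Nat.Properties as ℕProperties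
import Algebra.Properties.Ring as RingProperties
import Algebra.Properties.Group as GroupProperties
import Algebra.Properties.AbelianGroup as AbelianGroupProperties
import Algebra.Properties.CommutativeSemigroup as CommSemigroupProperties
import Algebra.Properties.Semiring.Mult as SemiringMultProperties

module Matrices {c ℓ} (R : CommutativeRing c ℓ) (n : ℕ) (e e* : Fin n → ℤ) where
  open CommutativeRing R public
    using (Carrier; _≈_; _+_; _*_; -_; 0#; 1#; rawRing; setoid; refl; sym; trans;
           +-cong; *-cong; -‿cong; +-comm; *-comm; +-assoc; *-assoc; distribˡ; distribʳ;
           zeroˡ; zeroʳ; +-identityˡ; +-identityʳ; *-identityˡ; *-identityʳ;
           -‿inverseˡ; -‿inverseʳ)
  open CommutativeRing R using (ring; +-group; +-abelianGroup; +-commutativeSemigroup)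
  open RingProperties ring public using (-‿distribˡ-*; -‿distribʳ-*; -‿involutive; -1*x≈-x)
  open GroupProperties +-group public using (ε⁻¹≈ε; ∙-cancelˡ; x∙y⁻¹≈ε⇒x≈y; x≈y⇒x∙y⁻¹≈ε)
  open AbelianGroupProperties +-abelianGroup public using (⁻¹-∙-comm)
  open CommSemigroupProperties +-commutativeSemigroup public using (interchange)
  open Lin rawRing n e e* public
  module ≈-Reasoning = SetoidReasoning setoid

  +-cancel-common : ∀ {x y p q α β} → x ≈ p + α → y ≈ q + β → x ≈ y → p ≈ q → α ≈ β
  +-cancel-common x≈p+α y≈q+β x≈y p≈q =
    ∙-cancelˡ _ _ _ (trans (sym x≈p+α) (trans x≈y (trans y≈q+β (+-cong (sym p≈q) refl))))

  Σ-cong : ∀ {m} {f g : Fin m → Carrier} → (∀ i → f i ≈ g i) → Σ[ f ] ≈ Σ[ g ]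
  Σ-cong {zero}  f≈g = refl
  Σ-cong {suc m} f≈g = +-cong (f≈g zero) (Σ-cong (λ i → f≈g (suc i)))

  Σ-0 : ∀ {m} → Σ[_] {m} (λ _ → 0#) ≈ 0#
  Σ-0 {zero}  = refl
  Σ-0 {suc m} = trans (+-identityˡ _) (Σ-0 {m})

  Σ-distrib-+ : ∀ {m} (f g : Fin m → Carrier) → Σ[ (λ i → f i + g i) ] ≈ Σ[ f ] + Σ[ g ]
  Σ-distrib-+ {zero}  f g = sym (+-identityˡ 0#)
  Σ-distrib-+ {suc m} f g =
    trans (+-cong refl (Σ-distrib-+ (λ i → f (suc i)) (λ i → g (suc i))))
          (interchange (f zero) (g zero) _ _)

  Σ-neg : ∀ {m} (f : Fin m → Carrier) → Σ[ (λ i → - f i) ] ≈ - Σ[ f ]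
  Σ-neg {zero}  f = sym ε⁻¹≈ε
  Σ-neg {suc m} f = trans (+-cong refl (Σ-neg (λ i → f (suc i)))) (⁻¹-∙-comm _ _)

  *-distribˡ-Σ : ∀ {m} x (f : Fin m → Carrier) → x * Σ[ f ] ≈ Σ[ (λ i → x * f i) ]
  *-distribˡ-Σ {zero}  x f = zeroʳ x
  *-distribˡ-Σ {suc m} x f = trans (distribˡ x _ _) (+-cong refl (*-distribˡ-Σ x (λ i → f (suc i))))

  *-distribʳ-Σ : ∀ {m} x (f : Fin m → Carrier) → Σ[ f ] * x ≈ Σ[ (λ i → f i * x) ]
  *-distribʳ-Σ {zero}  x f = zeroˡ x
  *-distribʳ-Σ {suc m} x f = trans (distribʳ x _ _) (+-cong refl (*-distribʳ-Σ x (λ i → f (suc i))))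

  Σ-comm : ∀ {m k} (f : Fin m → Fin k → Carrier) →
    Σ[ (λ i → Σ[ (λ j → f i j) ]) ] ≈ Σ[ (λ j → Σ[ (λ i → f i j) ]) ]
  Σ-comm {zero}  {k} f = sym (Σ-0 {k})
  Σ-comm {suc m} {k} f = trans (+-cong refl (Σ-comm (λ i → f (suc i))))
                               (sym (Σ-distrib-+ (λ j → f zero j) _))

  -- idM compares indices with _≟_, which does not compute under suc; δ is its structural twin.
  δ : ∀ {m} → Fin m → Fin m → Carrier
  δ zero    zero    = 1#
  δ zero    (suc j) = 0#
  δ (suc i) zero    = 0#
  δ (suc i) (suc j) = δ i j

  δ-refl : ∀ {m} (i : Fin m) → δ i i ≈ 1#
  δ-refl zero    = refl
  δ-refl (suc i) = δ-refl i

  δ-≢ : ∀ {m} (i j : Fin m) → ¬ i P.≡ j → δ i j ≈ 0#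
  δ-≢ zero    zero    i≢j = ⊥-elim (i≢j P.refl)
  δ-≢ zero    (suc j) i≢j = refl
  δ-≢ (suc i) zero    i≢j = refl
  δ-≢ (suc i) (suc j) i≢j = δ-≢ i j (λ i≡j → i≢j (P.cong suc i≡j))

  idM≈δ : ∀ i j → idM i j ≈ δ i j
  idM≈δ i j with Data.Fin._≟_ i j
  ... | yes P.refl = sym (δ-refl i)
  ... | no  i≢j    = sym (δ-≢ i j i≢j)

  Σ-δˡ : ∀ {m} (i : Fin m) (f : Fin m → Carrier) → Σ[ (λ k → δ i k * f k) ] ≈ f i
  Σ-δˡ {suc m} zero f =
    trans (+-cong (*-identityˡ _) (trans (Σ-cong (λ k → zeroˡ (f (suc k)))) (Σ-0 {m}))) (+-identityʳ _)
  Σ-δˡ {suc m} (suc i) f = trans (+-cong (zeroˡ _) (Σ-δˡ i (λ k → f (suc k)))) (+-identityˡ _)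

  Σ-δʳ : ∀ {m} (i : Fin m) (f : Fin m → Carrier) → Σ[ (λ k → f k * δ k i) ] ≈ f i
  Σ-δʳ {suc m} zero f =
    trans (+-cong (*-identityʳ _) (trans (Σ-cong (λ k → zeroʳ (f (suc k)))) (Σ-0 {m}))) (+-identityʳ _)
  Σ-δʳ {suc m} (suc i) f = trans (+-cong (zeroʳ _) (Σ-δʳ i (λ k → f (suc k)))) (+-identityˡ _)

  Σ-idMˡ : ∀ i (f : Fin n → Carrier) → Σ[ (λ k → idM i k * f k) ] ≈ f i
  Σ-idMˡ i f = trans (Σ-cong (λ k → *-cong (idM≈δ i k) refl)) (Σ-δˡ i f)

  Σ-idMʳ : ∀ i (f : Fin n → Carrier) → Σ[ (λ k → f k * idM k i) ] ≈ f i
  Σ-idMʳ i f = trans (Σ-cong (λ k → *-cong refl (idM≈δ k i))) (Σ-δʳ i f)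

  infixl 6 _+ᵥ_ _-ᵥ_
  infixr 7 _∙ᵥ_

  _+ᵥ_ : Vec → Vec → Vec
  (v +ᵥ w) i = v i + w i

  _-ᵥ_ : Vec → Vec → Vec
  (v -ᵥ w) i = v i + - w i

  _∙ᵥ_ : Carrier → Vec → Vec
  (r ∙ᵥ v) i = r * v i

  vecSetoid : Setoid c ℓ
  vecSetoid = record
    { Carrier = Vec ; _≈_ = _≈ᵥ_
    ; isEquivalence = record { refl = λ i → refl ; sym = λ p i → sym (p i)
                             ; trans = λ p q i → trans (p i) (q i) } }

  matSetoid : Setoid c ℓ
  matSetoid = record
    { Carrier = Mat ; _≈_ = _≈ₘ_
    ; isEquivalence = record { refl = λ i j → refl ; sym = λ p i j → sym (p i j)
                             ; trans = λ p q i j → trans (p i j) (q i j) } }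

  module ≈ᵥ-Reasoning = SetoidReasoning vecSetoid
  module ≈ₘ-Reasoning = SetoidReasoning matSetoid
  open Setoid vecSetoid public using () renaming (refl to reflᵥ; sym to symᵥ; trans to transᵥ)
  open Setoid matSetoid public using () renaming (refl to reflₘ; sym to symₘ; trans to transₘ)

  ⟨⟩-cong : ∀ {l l' v v'} → l ≈ᵥ l' → v ≈ᵥ v' → ⟨ l , v ⟩ ≈ ⟨ l' , v' ⟩
  ⟨⟩-cong p q = Σ-cong (λ k → *-cong (p k) (q k))

  ⟨⟩-+ˡ : ∀ l m v → ⟨ l +ᵥ m , v ⟩ ≈ ⟨ l , v ⟩ + ⟨ m , v ⟩
  ⟨⟩-+ˡ l m v = trans (Σ-cong (λ k → distribʳ (v k) (l k) (m k))) (Σ-distrib-+ {n} _ _)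

  ⟨⟩-+ʳ : ∀ l v w → ⟨ l , v +ᵥ w ⟩ ≈ ⟨ l , v ⟩ + ⟨ l , w ⟩
  ⟨⟩-+ʳ l v w = trans (Σ-cong (λ k → distribˡ (l k) (v k) (w k))) (Σ-distrib-+ {n} _ _)

  ⟨⟩-negˡ : ∀ l v → ⟨ (λ k → - l k) , v ⟩ ≈ - ⟨ l , v ⟩
  ⟨⟩-negˡ l v = trans (Σ-cong (λ k → sym (-‿distribˡ-* (l k) (v k)))) (Σ-neg {n} _)

  ⟨⟩-negʳ : ∀ l v → ⟨ l , (λ k → - v k) ⟩ ≈ - ⟨ l , v ⟩
  ⟨⟩-negʳ l v = trans (Σ-cong (λ k → sym (-‿distribʳ-* (l k) (v k)))) (Σ-neg {n} _)

  ⟨⟩--ˡ : ∀ l m v → ⟨ l -ᵥ m , v ⟩ ≈ ⟨ l , v ⟩ + - ⟨ m , v ⟩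
  ⟨⟩--ˡ l m v = trans (⟨⟩-+ˡ l _ v) (+-cong refl (⟨⟩-negˡ m v))

  ⟨⟩--ʳ : ∀ l v w → ⟨ l , v -ᵥ w ⟩ ≈ ⟨ l , v ⟩ + - ⟨ l , w ⟩
  ⟨⟩--ʳ l v w = trans (⟨⟩-+ʳ l v _) (+-cong refl (⟨⟩-negʳ l w))

  ⟨⟩-∙ˡ : ∀ r l v → ⟨ r ∙ᵥ l , v ⟩ ≈ r * ⟨ l , v ⟩
  ⟨⟩-∙ˡ r l v = trans (Σ-cong (λ k → *-assoc r (l k) (v k))) (sym (*-distribˡ-Σ {n} r _))

  ⟨⟩-∙ʳ : ∀ r l v → ⟨ l , r ∙ᵥ v ⟩ ≈ r * ⟨ l , v ⟩
  ⟨⟩-∙ʳ r l v = trans (Σ-cong swap) (sym (*-distribˡ-Σ {n} r _))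
    where
    swap : ∀ k → l k * (r * v k) ≈ r * (l k * v k)
    swap k = trans (sym (*-assoc (l k) r (v k)))
                   (trans (*-cong (*-comm (l k) r) refl) (*-assoc r (l k) (v k)))

  ⟨⟩-0ˡ : ∀ v → ⟨ 0ᵥ , v ⟩ ≈ 0#
  ⟨⟩-0ˡ v = trans (Σ-cong (λ k → zeroˡ (v k))) (Σ-0 {n})

  ⟨⟩-0ʳ : ∀ l → ⟨ l , 0ᵥ ⟩ ≈ 0#
  ⟨⟩-0ʳ l = trans (Σ-cong (λ k → zeroʳ (l k))) (Σ-0 {n})

  ⟨⟩-assoc : ∀ l x v → ⟨ l ᵥ· x , v ⟩ ≈ ⟨ l , x ·ᵥ v ⟩
  ⟨⟩-assoc l x v =
    trans (Σ-cong (λ k → *-distribʳ-Σ (v k) (λ j → l j * x j k)))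
    (trans (Σ-comm (λ k j → (l j * x j k) * v k))
           (Σ-cong (λ j → trans (Σ-cong (λ k → *-assoc (l j) (x j k) (v k)))
                                (sym (*-distribˡ-Σ {n} (l j) _)))))

  col : Mat → Fin n → Vec
  col x j k = x k j

  ⊗-cong : ∀ {x x' y y'} → x ≈ₘ x' → y ≈ₘ y' → (x ⊗ y) ≈ₘ (x' ⊗ y')
  ⊗-cong p q i j = ⟨⟩-cong (p i) (λ k → q k j)

  ·ᵥ-cong : ∀ {x x' v v'} → x ≈ₘ x' → v ≈ᵥ v' → (x ·ᵥ v) ≈ᵥ (x' ·ᵥ v')
  ·ᵥ-cong p q i = ⟨⟩-cong (p i) q

  ᵥ·-cong : ∀ {l l' x x'} → l ≈ᵥ l' → x ≈ₘ x' → (l ᵥ· x) ≈ᵥ (l' ᵥ· x')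
  ᵥ·-cong p q j = ⟨⟩-cong p (λ k → q k j)

  +ₘ-cong : ∀ {x x' y y'} → x ≈ₘ x' → y ≈ₘ y' → (x +ₘ y) ≈ₘ (x' +ₘ y')
  +ₘ-cong p q i j = +-cong (p i j) (q i j)

  -ₘ-cong : ∀ {x x' y y'} → x ≈ₘ x' → y ≈ₘ y' → (x -ₘ y) ≈ₘ (x' -ₘ y')
  -ₘ-cong p q i j = +-cong (p i j) (-‿cong (q i j))

  ∙ₘ-cong : ∀ {r r' x x'} → r ≈ r' → x ≈ₘ x' → (r ∙ₘ x) ≈ₘ (r' ∙ₘ x')
  ∙ₘ-cong p q i j = *-cong p (q i j)

  +ₘ-inverseʳ : ∀ {x x'} → x ≈ₘ x' → (x +ₘ (0ₘ -ₘ x')) ≈ₘ 0ₘ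
  +ₘ-inverseʳ x≈x' i j = trans (+-cong (x≈x' i j) (+-identityˡ _)) (-‿inverseʳ _)

  +ₘ-inverseˡ : ∀ {x x'} → x ≈ₘ x' → ((0ₘ -ₘ x) +ₘ x') ≈ₘ 0ₘ
  +ₘ-inverseˡ x≈x' i j = trans (+-cong (+-identityˡ _) (sym (x≈x' i j))) (-‿inverseˡ _)

  ⊗-assoc : ∀ x y z → ((x ⊗ y) ⊗ z) ≈ₘ (x ⊗ (y ⊗ z))
  ⊗-assoc x y z i j = ⟨⟩-assoc (x i) y (col z j)

  ·ᵥ-assoc : ∀ x y v → ((x ⊗ y) ·ᵥ v) ≈ᵥ (x ·ᵥ (y ·ᵥ v))
  ·ᵥ-assoc x y v i = ⟨⟩-assoc (x i) y v

  ᵥ·-assoc : ∀ l x y → ((l ᵥ· x) ᵥ· y) ≈ᵥ (l ᵥ· (x ⊗ y))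
  ᵥ·-assoc l x y j = ⟨⟩-assoc l x (col y j)

  ⊗-identityˡ : ∀ x → (idM ⊗ x) ≈ₘ x
  ⊗-identityˡ x i j = Σ-idMˡ i (col x j)

  ⊗-identityʳ : ∀ x → (x ⊗ idM) ≈ₘ x
  ⊗-identityʳ x i j = Σ-idMʳ j (x i)

  ·ᵥ-identity : ∀ v → (idM ·ᵥ v) ≈ᵥ v
  ·ᵥ-identity v i = Σ-idMˡ i v

  ᵥ·-identity : ∀ l → (l ᵥ· idM) ≈ᵥ l
  ᵥ·-identity l j = Σ-idMʳ j l

  ⊗-distribˡ-+ₘ : ∀ x y z → (x ⊗ (y +ₘ z)) ≈ₘ ((x ⊗ y) +ₘ (x ⊗ z))
  ⊗-distribˡ-+ₘ x y z i j = ⟨⟩-+ʳ (x i) (col y j) (col z j)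

  ⊗-distribʳ-+ₘ : ∀ x y z → ((y +ₘ z) ⊗ x) ≈ₘ ((y ⊗ x) +ₘ (z ⊗ x))
  ⊗-distribʳ-+ₘ x y z i j = ⟨⟩-+ˡ (y i) (z i) (col x j)

  ⊗-distribˡ--ₘ : ∀ x y z → (x ⊗ (y -ₘ z)) ≈ₘ ((x ⊗ y) -ₘ (x ⊗ z))
  ⊗-distribˡ--ₘ x y z i j = ⟨⟩--ʳ (x i) (col y j) (col z j)

  ⊗-distribʳ--ₘ : ∀ x y z → ((y -ₘ z) ⊗ x) ≈ₘ ((y ⊗ x) -ₘ (z ⊗ x))
  ⊗-distribʳ--ₘ x y z i j = ⟨⟩--ˡ (y i) (z i) (col x j)

  ⊗-∙ₘˡ : ∀ r x y → ((r ∙ₘ x) ⊗ y) ≈ₘ (r ∙ₘ (x ⊗ y))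
  ⊗-∙ₘˡ r x y i j = ⟨⟩-∙ˡ r (x i) (col y j)

  ⊗-∙ₘʳ : ∀ r x y → (x ⊗ (r ∙ₘ y)) ≈ₘ (r ∙ₘ (x ⊗ y))
  ⊗-∙ₘʳ r x y i j = ⟨⟩-∙ʳ r (x i) (col y j)

  ⊗-zeroˡ : ∀ x → (0ₘ ⊗ x) ≈ₘ 0ₘ
  ⊗-zeroˡ x i j = ⟨⟩-0ˡ (col x j)

  ⊗-zeroʳ : ∀ x → (x ⊗ 0ₘ) ≈ₘ 0ₘ
  ⊗-zeroʳ x i j = ⟨⟩-0ʳ (x i)

  ⊗-negʳ : ∀ x y → (x ⊗ (0ₘ -ₘ y)) ≈ₘ (0ₘ -ₘ (x ⊗ y))
  ⊗-negʳ x y = transₘ (⊗-distribˡ--ₘ x 0ₘ y) (-ₘ-cong (⊗-zeroʳ x) reflₘ)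

  ⊗-negˡ : ∀ x y → ((0ₘ -ₘ y) ⊗ x) ≈ₘ (0ₘ -ₘ (y ⊗ x))
  ⊗-negˡ x y = transₘ (⊗-distribʳ--ₘ x 0ₘ y) (-ₘ-cong (⊗-zeroˡ x) reflₘ)

  ·ᵥ-distribʳ-+ₘ : ∀ x y v → ((x +ₘ y) ·ᵥ v) ≈ᵥ ((x ·ᵥ v) +ᵥ (y ·ᵥ v))
  ·ᵥ-distribʳ-+ₘ x y v i = ⟨⟩-+ˡ (x i) (y i) v

  ·ᵥ-distribʳ--ₘ : ∀ x y v → ((x -ₘ y) ·ᵥ v) ≈ᵥ ((x ·ᵥ v) -ᵥ (y ·ᵥ v))
  ·ᵥ-distribʳ--ₘ x y v i = ⟨⟩--ˡ (x i) (y i) v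

  ·ᵥ-∙ₘ : ∀ r x v → ((r ∙ₘ x) ·ᵥ v) ≈ᵥ (r ∙ᵥ (x ·ᵥ v))
  ·ᵥ-∙ₘ r x v i = ⟨⟩-∙ˡ r (x i) v

  ·ᵥ-∙ᵥ : ∀ r x v → (x ·ᵥ (r ∙ᵥ v)) ≈ᵥ (r ∙ᵥ (x ·ᵥ v))
  ·ᵥ-∙ᵥ r x v i = ⟨⟩-∙ʳ r (x i) v

  ·ᵥ-zeroˡ : ∀ v → (0ₘ ·ᵥ v) ≈ᵥ 0ᵥ
  ·ᵥ-zeroˡ v i = ⟨⟩-0ˡ v

  ·ᵥ-zeroʳ : ∀ x → (x ·ᵥ 0ᵥ) ≈ᵥ 0ᵥ
  ·ᵥ-zeroʳ x i = ⟨⟩-0ʳ (x i)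

  ᵥ·-distribˡ-+ₘ : ∀ l x y → (l ᵥ· (x +ₘ y)) ≈ᵥ ((l ᵥ· x) +ᵥ (l ᵥ· y))
  ᵥ·-distribˡ-+ₘ l x y j = ⟨⟩-+ʳ l (col x j) (col y j)

  ᵥ·-distribˡ--ₘ : ∀ l x y → (l ᵥ· (x -ₘ y)) ≈ᵥ ((l ᵥ· x) -ᵥ (l ᵥ· y))
  ᵥ·-distribˡ--ₘ l x y j = ⟨⟩--ʳ l (col x j) (col y j)

  ᵥ·-zeroˡ : ∀ x → (0ᵥ ᵥ· x) ≈ᵥ 0ᵥ
  ᵥ·-zeroˡ x j = ⟨⟩-0ˡ (col x j)

  outer-⊗ˡ : ∀ x v l → (x ⊗ outer v l) ≈ₘ outer (x ·ᵥ v) l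
  outer-⊗ˡ x v l i j = trans (Σ-cong (λ k → sym (*-assoc (x i k) (v k) (l j))))
                             (sym (*-distribʳ-Σ {n} (l j) _))

  outer-⊗ʳ : ∀ v l x → (outer v l ⊗ x) ≈ₘ outer v (l ᵥ· x)
  outer-⊗ʳ v l x i j = trans (Σ-cong (λ k → *-assoc (v i) (l k) (x k j)))
                             (sym (*-distribˡ-Σ {n} (v i) _))

  outer-·ᵥ : ∀ v l w → (outer v l ·ᵥ w) ≈ᵥ (⟨ l , w ⟩ ∙ᵥ v)
  outer-·ᵥ v l w i = trans (Σ-cong (λ k → *-assoc (v i) (l k) (w k)))
                           (trans (sym (*-distribˡ-Σ {n} (v i) _)) (*-comm _ _))

  ᵥ·-outer : ∀ l v m → (l ᵥ· outer v m) ≈ᵥ (⟨ l , v ⟩ ∙ᵥ m)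
  ᵥ·-outer l v m j = trans (Σ-cong (λ k → sym (*-assoc (l k) (v k) (m j))))
                           (sym (*-distribʳ-Σ {n} (m j) _))

  comm-identity : ∀ x → Commute x idM
  comm-identity x = transₘ (⊗-identityʳ x) (symₘ (⊗-identityˡ x))

  comm-⊗ : ∀ {x y z} → Commute x y → Commute x z → Commute x (y ⊗ z)
  comm-⊗ {x} {y} {z} xy xz = begin
    x ⊗ (y ⊗ z)  ≈⟨ symₘ (⊗-assoc x y z) ⟩
    (x ⊗ y) ⊗ z  ≈⟨ ⊗-cong xy reflₘ ⟩
    (y ⊗ x) ⊗ z  ≈⟨ ⊗-assoc y x z ⟩
    y ⊗ (x ⊗ z)  ≈⟨ ⊗-cong reflₘ xz ⟩
    y ⊗ (z ⊗ x)  ≈⟨ symₘ (⊗-assoc y z x) ⟩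
    (y ⊗ z) ⊗ x  ∎
    where open ≈ₘ-Reasoning

  comm-poly : ∀ {x y} → Commute x y → ∀ p → Commute x (poly p y)
  comm-poly {x}     xy []       = transₘ (⊗-zeroʳ x) (symₘ (⊗-zeroˡ x))
  comm-poly {x} {y} xy (r ∷ cs) = begin
    x ⊗ ((r ∙ₘ idM) +ₘ (y ⊗ P))        ≈⟨ ⊗-distribˡ-+ₘ x _ _ ⟩
    (x ⊗ (r ∙ₘ idM)) +ₘ (x ⊗ (y ⊗ P))  ≈⟨ +ₘ-cong (⊗-∙ₘʳ r x idM) (comm-⊗ xy (comm-poly xy cs)) ⟩
    (r ∙ₘ (x ⊗ idM)) +ₘ ((y ⊗ P) ⊗ x)  ≈⟨ +ₘ-cong (∙ₘ-cong refl (comm-identity x)) reflₘ ⟩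
    (r ∙ₘ (idM ⊗ x)) +ₘ ((y ⊗ P) ⊗ x)  ≈⟨ +ₘ-cong (symₘ (⊗-∙ₘˡ r idM x)) reflₘ ⟩
    ((r ∙ₘ idM) ⊗ x) +ₘ ((y ⊗ P) ⊗ x)  ≈⟨ symₘ (⊗-distribʳ-+ₘ x _ _) ⟩
    ((r ∙ₘ idM) +ₘ (y ⊗ P)) ⊗ x        ∎
    where
    open ≈ₘ-Reasoning
    P = poly cs y

  comm-respʳ : ∀ {x y y'} → y ≈ₘ y' → Commute x y → Commute x y'
  comm-respʳ y≈y' xy = transₘ (⊗-cong reflₘ (symₘ y≈y')) (transₘ xy (⊗-cong y≈y' reflₘ))

  comm-∙ₘ : ∀ {x y} r → Commute x y → Commute x (r ∙ₘ y)
  comm-∙ₘ {x} {y} r xy = transₘ (⊗-∙ₘʳ r x y) (transₘ (∙ₘ-cong refl xy) (symₘ (⊗-∙ₘˡ r y x)))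

  comm--ₘ : ∀ {x y z} → Commute x y → Commute x z → Commute x (y -ₘ z)
  comm--ₘ {x} {y} {z} xy xz =
    transₘ (⊗-distribˡ--ₘ x y z) (transₘ (-ₘ-cong xy xz) (symₘ (⊗-distribʳ--ₘ x y z)))

  comm-^ : ∀ {x y} → Commute x y → ∀ j → Commute x (y ^ j)
  comm-^ {x} xy zero    = comm-identity x
  comm-^ {x} xy (suc j) = comm-⊗ xy (comm-^ xy j)

  ^-suc-comm : ∀ y j → ((y ^ j) ⊗ y) ≈ₘ (y ^ suc j)
  ^-suc-comm y j = symₘ (comm-^ {y} reflₘ j)

  comm-inverse : ∀ {a a⁻¹ τ} → IsInv a a⁻¹ → Commute a τ → Commute a⁻¹ τ
  comm-inverse {a} {a⁻¹} {τ} (aa⁻¹ , a⁻¹a) aτ = begin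
    a⁻¹ ⊗ τ                ≈⟨ symₘ (⊗-identityʳ _) ⟩
    (a⁻¹ ⊗ τ) ⊗ idM        ≈⟨ ⊗-cong reflₘ (symₘ aa⁻¹) ⟩
    (a⁻¹ ⊗ τ) ⊗ (a ⊗ a⁻¹)  ≈⟨ ⊗-assoc a⁻¹ τ _ ⟩
    a⁻¹ ⊗ (τ ⊗ (a ⊗ a⁻¹))  ≈⟨ ⊗-cong reflₘ (symₘ (⊗-assoc τ a a⁻¹)) ⟩
    a⁻¹ ⊗ ((τ ⊗ a) ⊗ a⁻¹)  ≈⟨ ⊗-cong reflₘ (⊗-cong (symₘ aτ) reflₘ) ⟩
    a⁻¹ ⊗ ((a ⊗ τ) ⊗ a⁻¹)  ≈⟨ ⊗-cong reflₘ (⊗-assoc a τ a⁻¹) ⟩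
    a⁻¹ ⊗ (a ⊗ (τ ⊗ a⁻¹))  ≈⟨ symₘ (⊗-assoc a⁻¹ a _) ⟩
    (a⁻¹ ⊗ a) ⊗ (τ ⊗ a⁻¹)  ≈⟨ ⊗-cong a⁻¹a reflₘ ⟩
    idM ⊗ (τ ⊗ a⁻¹)        ≈⟨ ⊗-identityˡ _ ⟩
    τ ⊗ a⁻¹                ∎
    where open ≈ₘ-Reasoning

  record IsLinear (F : Mat → Carrier) : Set (c ⊔ ℓ) where
    field
      cong : ∀ {X Y} → X ≈ₘ Y → F X ≈ F Y
      +-homo : ∀ X Y → F (X +ₘ Y) ≈ F X + F Y
      ∙-homo : ∀ r X → F (r ∙ₘ X) ≈ r * F X
      0-homo : F 0ₘ ≈ 0#

  module _ {F : Mat → Carrier} (F-lin : IsLinear F) where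
    open IsLinear F-lin

    IsLinear-∘⊗ˡ : ∀ M → IsLinear (λ X → F (M ⊗ X))
    IsLinear-∘⊗ˡ M = record
      { cong   = λ p → cong (⊗-cong reflₘ p)
      ; +-homo = λ X Y → trans (cong (⊗-distribˡ-+ₘ M X Y)) (+-homo _ _)
      ; ∙-homo = λ r X → trans (cong (⊗-∙ₘʳ r M X)) (∙-homo r _)
      ; 0-homo = trans (cong (⊗-zeroʳ M)) 0-homo }

    IsLinear-∘⊗ʳ : ∀ M → IsLinear (λ X → F (X ⊗ M))
    IsLinear-∘⊗ʳ M = record
      { cong   = λ p → cong (⊗-cong p reflₘ)
      ; +-homo = λ X Y → trans (cong (⊗-distribʳ-+ₘ M X Y)) (+-homo _ _)
      ; ∙-homo = λ r X → trans (cong (⊗-∙ₘˡ r X M)) (∙-homo r _)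
      ; 0-homo = trans (cong (⊗-zeroˡ M)) 0-homo }

    IsLinear-*ʳ : ∀ s → IsLinear (λ X → F X * s)
    IsLinear-*ʳ s = record
      { cong   = λ p → *-cong (cong p) refl
      ; +-homo = λ X Y → trans (*-cong (+-homo X Y) refl) (distribʳ s _ _)
      ; ∙-homo = λ r X → trans (*-cong (∙-homo r X) refl) (*-assoc r _ s)
      ; 0-homo = trans (*-cong 0-homo refl) (zeroˡ s) }

    combination-homo : ∀ r X s Y → F ((r ∙ₘ X) -ₘ (s ∙ₘ Y)) ≈ r * F X + - (s * F Y)
    combination-homo r X s Y = begin
      F ((r ∙ₘ X) -ₘ (s ∙ₘ Y))          ≈⟨ cong (λ i j → +-cong refl (-1*x≈-x _)) ⟨
      F ((r ∙ₘ X) +ₘ ((- 1#) ∙ₘ (s ∙ₘ Y)))  ≈⟨ +-homo _ _ ⟩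
      F (r ∙ₘ X) + F ((- 1#) ∙ₘ (s ∙ₘ Y))  ≈⟨ +-cong (∙-homo r X) (trans (∙-homo (- 1#) _) (-1*x≈-x _)) ⟩
      r * F X + - F (s ∙ₘ Y)              ≈⟨ +-cong refl (-‿cong (∙-homo s Y)) ⟩
      r * F X + - (s * F Y)               ∎
      where open ≈-Reasoning

  IsLinear-agree-poly : ∀ {τ F G} → IsLinear F → IsLinear G →
    (∀ i → F (τ ^ i) ≈ G (τ ^ i)) → ∀ p → F (poly p τ) ≈ G (poly p τ)
  IsLinear-agree-poly {τ} F-lin G-lin F≈G [] = trans (IsLinear.0-homo F-lin) (sym (IsLinear.0-homo G-lin))
  IsLinear-agree-poly {τ} {F} {G} F-lin G-lin F≈G (r ∷ cs) = begin
    F ((r ∙ₘ idM) +ₘ (τ ⊗ poly cs τ))      ≈⟨ F.+-homo _ _ ⟩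
    F (r ∙ₘ idM) + F (τ ⊗ poly cs τ)       ≈⟨ +-cong (F.∙-homo r idM) refl ⟩
    r * F idM + F (τ ⊗ poly cs τ)          ≈⟨ +-cong (*-cong refl (F≈G 0)) tail ⟩
    r * G idM + G (τ ⊗ poly cs τ)          ≈⟨ +-cong (G.∙-homo r idM) refl ⟨
    G (r ∙ₘ idM) + G (τ ⊗ poly cs τ)       ≈⟨ G.+-homo _ _ ⟨
    G ((r ∙ₘ idM) +ₘ (τ ⊗ poly cs τ))      ∎
    where
    open ≈-Reasoning
    module F = IsLinear F-lin
    module G = IsLinear G-lin
    tail : F (τ ⊗ poly cs τ) ≈ G (τ ⊗ poly cs τ)
    tail = IsLinear-agree-poly (IsLinear-∘⊗ˡ F-lin τ) (IsLinear-∘⊗ˡ G-lin τ) (λ i → F≈G (suc i)) cs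

  IsLinear-pairing : ∀ l v → IsLinear (λ x → ⟨ l , x ·ᵥ v ⟩)
  IsLinear-pairing l v = record
    { cong   = λ p → ⟨⟩-cong reflᵥ (·ᵥ-cong p reflᵥ)
    ; +-homo = λ x y → trans (⟨⟩-cong reflᵥ (·ᵥ-distribʳ-+ₘ x y v)) (⟨⟩-+ʳ l _ _)
    ; ∙-homo = λ r x → trans (⟨⟩-cong reflᵥ (·ᵥ-∙ₘ r x v)) (⟨⟩-∙ʳ r l _)
    ; 0-homo = trans (⟨⟩-cong reflᵥ (·ᵥ-zeroˡ v)) (⟨⟩-0ʳ l) }

  entry : Mat → Carrier
  entry x = ⟨ e*R , x ·ᵥ eR ⟩

  entry-linear : IsLinear entry
  entry-linear = IsLinear-pairing e*R eR

  open IsLinear entry-linear public using () renaming (cong to entry-cong)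

  IsLinear-0 : IsLinear (λ _ → 0#)
  IsLinear-0 = record
    { cong = λ _ → refl ; +-homo = λ _ _ → sym (+-identityʳ 0#)
    ; ∙-homo = λ r _ → sym (zeroʳ r) ; 0-homo = refl }

module Hyperplane {c ℓ} (R : CommutativeRing c ℓ) (n : ℕ) (e e* : Fin n → ℤ) where
  open Matrices R n e e* public

  E : Mat
  E = outer eR e*R

  idM≈1H+E : idM ≈ₘ (1H +ₘ E)
  idM≈1H+E i j = sym (trans (+-assoc _ _ _) (trans (+-cong refl (-‿inverseˡ _)) (+-identityʳ _)))

  E-·ᵥ : ∀ v → (E ·ᵥ v) ≈ᵥ (⟨ e*R , v ⟩ ∙ᵥ eR)
  E-·ᵥ = outer-·ᵥ eR e*R

  entry-⊗E⊗ : ∀ X Y → entry (X ⊗ (E ⊗ Y)) ≈ entry X * entry Y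
  entry-⊗E⊗ X Y = begin
    ⟨ e*R , (X ⊗ (E ⊗ Y)) ·ᵥ eR ⟩    ≈⟨ ⟨⟩-cong reflᵥ (transᵥ (·ᵥ-assoc X (E ⊗ Y) eR)
                                          (·ᵥ-cong reflₘ (transᵥ (·ᵥ-assoc E Y eR) (E-·ᵥ (Y ·ᵥ eR))))) ⟩
    ⟨ e*R , X ·ᵥ (entry Y ∙ᵥ eR) ⟩    ≈⟨ ⟨⟩-cong reflᵥ (·ᵥ-∙ᵥ (entry Y) X eR) ⟩
    ⟨ e*R , entry Y ∙ᵥ (X ·ᵥ eR) ⟩    ≈⟨ ⟨⟩-∙ʳ (entry Y) e*R _ ⟩
    entry Y * entry X                 ≈⟨ *-comm _ _ ⟩
    entry X * entry Y                 ∎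
    where open ≈-Reasoning

  Φ : Mat → Mat → Mat → Carrier
  Φ K X Y = entry (X ⊗ (K ⊗ Y))

  Φ-cong : ∀ {K K' X X' Y Y'} → K ≈ₘ K' → X ≈ₘ X' → Y ≈ₘ Y' → Φ K X Y ≈ Φ K' X' Y'
  Φ-cong p q r = entry-cong (⊗-cong q (⊗-cong p r))

  Φ-linearˡ : ∀ K Y → IsLinear (λ X → Φ K X Y)
  Φ-linearˡ K Y = IsLinear-∘⊗ʳ entry-linear (K ⊗ Y)

  Φ-linearʳ : ∀ K X → IsLinear (λ Y → Φ K X Y)
  Φ-linearʳ K X = IsLinear-∘⊗ˡ (IsLinear-∘⊗ˡ entry-linear X) K

  entry-⊗-split : ∀ X Y → entry (X ⊗ Y) ≈ Φ 1H X Y + entry X * entry Y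
  entry-⊗-split X Y = begin
    entry (X ⊗ Y)                                  ≈⟨ entry-cong (⊗-cong reflₘ (symₘ (⊗-identityˡ Y))) ⟩
    entry (X ⊗ (idM ⊗ Y))                          ≈⟨ entry-cong (⊗-cong reflₘ (⊗-cong idM≈1H+E reflₘ)) ⟩
    entry (X ⊗ ((1H +ₘ E) ⊗ Y))                    ≈⟨ entry-cong (⊗-cong reflₘ (⊗-distribʳ-+ₘ Y 1H E)) ⟩
    entry (X ⊗ ((1H ⊗ Y) +ₘ (E ⊗ Y)))              ≈⟨ entry-cong (⊗-distribˡ-+ₘ X _ _) ⟩
    entry ((X ⊗ (1H ⊗ Y)) +ₘ (X ⊗ (E ⊗ Y)))        ≈⟨ IsLinear.+-homo entry-linear _ _ ⟩
    Φ 1H X Y + entry (X ⊗ (E ⊗ Y))                 ≈⟨ +-cong refl (entry-⊗E⊗ X Y) ⟩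
    Φ 1H X Y + entry X * entry Y                   ∎
    where open ≈-Reasoning

  e*-annihilates⇒preserves-VH : ∀ {u} → (e*R ᵥ· u) ≈ᵥ 0ᵥ → ∀ v → InVH (u ·ᵥ v)
  e*-annihilates⇒preserves-VH {u} e*u≈0 v =
    trans (sym (⟨⟩-assoc e*R u v)) (trans (⟨⟩-cong e*u≈0 reflᵥ) (⟨⟩-0ˡ v))

  module Normalised (e*e≈1 : ⟨ e*R , eR ⟩ ≈ 1#) where

    1H-·ᵥ-VH : ∀ {z} → InVH z → (1H ·ᵥ z) ≈ᵥ z
    1H-·ᵥ-VH {z} e*z≈0 i = begin
      (1H ·ᵥ z) i                   ≈⟨ ·ᵥ-distribʳ--ₘ idM E z i ⟩
      (idM ·ᵥ z) i + - (E ·ᵥ z) i   ≈⟨ +-cong (·ᵥ-identity z i) (-‿cong (E-·ᵥ z i)) ⟩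
      z i + - (⟨ e*R , z ⟩ * eR i)  ≈⟨ +-cong refl (-‿cong (trans (*-cong e*z≈0 refl) (zeroˡ _))) ⟩
      z i + - 0#                    ≈⟨ +-cong refl ε⁻¹≈ε ⟩
      z i + 0#                      ≈⟨ +-identityʳ _ ⟩
      z i                           ∎
      where open ≈-Reasoning

    1H-·ᵥ-e : (1H ·ᵥ eR) ≈ᵥ 0ᵥ
    1H-·ᵥ-e i = begin
      (1H ·ᵥ eR) i                    ≈⟨ ·ᵥ-distribʳ--ₘ idM E eR i ⟩
      (idM ·ᵥ eR) i + - (E ·ᵥ eR) i   ≈⟨ +-cong (·ᵥ-identity eR i) (-‿cong (E-·ᵥ eR i)) ⟩
      eR i + - (⟨ e*R , eR ⟩ * eR i)  ≈⟨ +-cong refl (-‿cong (trans (*-cong e*e≈1 refl) (*-identityˡ _))) ⟩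
      eR i + - eR i                   ≈⟨ -‿inverseʳ _ ⟩
      0#                              ∎
      where open ≈-Reasoning

    e*-ᵥ·-1H : (e*R ᵥ· 1H) ≈ᵥ 0ᵥ
    e*-ᵥ·-1H j = begin
      (e*R ᵥ· 1H) j                    ≈⟨ ᵥ·-distribˡ--ₘ e*R idM E j ⟩
      (e*R ᵥ· idM) j + - (e*R ᵥ· E) j  ≈⟨ +-cong (ᵥ·-identity e*R j) (-‿cong (ᵥ·-outer e*R eR e*R j)) ⟩
      e*R j + - (⟨ e*R , eR ⟩ * e*R j) ≈⟨ +-cong refl (-‿cong (trans (*-cong e*e≈1 refl) (*-identityˡ _))) ⟩
      e*R j + - e*R j                  ≈⟨ -‿inverseʳ _ ⟩
      0#                               ∎
      where open ≈-Reasoning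

    ⊗-1H : ∀ {K} → (K ·ᵥ eR) ≈ᵥ 0ᵥ → (K ⊗ 1H) ≈ₘ K
    ⊗-1H {K} Ke≈0 i j = begin
      (K ⊗ 1H) i j                   ≈⟨ ⊗-distribˡ--ₘ K idM E i j ⟩
      (K ⊗ idM) i j + - (K ⊗ E) i j  ≈⟨ +-cong (⊗-identityʳ K i j) (-‿cong (outer-⊗ˡ K eR e*R i j)) ⟩
      K i j + - ((K ·ᵥ eR) i * e*R j) ≈⟨ +-cong refl (-‿cong (trans (*-cong (Ke≈0 i) refl) (zeroˡ _))) ⟩
      K i j + - 0#                   ≈⟨ +-cong refl ε⁻¹≈ε ⟩
      K i j + 0#                     ≈⟨ +-identityʳ _ ⟩
      K i j                          ∎
      where open ≈-Reasoning

    1H-⊗ : ∀ {K} → (e*R ᵥ· K) ≈ᵥ 0ᵥ → (1H ⊗ K) ≈ₘ K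
    1H-⊗ {K} e*K≈0 i j = begin
      (1H ⊗ K) i j                   ≈⟨ ⊗-distribʳ--ₘ K idM E i j ⟩
      (idM ⊗ K) i j + - (E ⊗ K) i j  ≈⟨ +-cong (⊗-identityˡ K i j) (-‿cong (outer-⊗ʳ eR e*R K i j)) ⟩
      K i j + - (eR i * (e*R ᵥ· K) j) ≈⟨ +-cong refl (-‿cong (trans (*-cong refl (e*K≈0 j)) (zeroʳ _))) ⟩
      K i j + - 0#                   ≈⟨ +-cong refl ε⁻¹≈ε ⟩
      K i j + 0#                     ≈⟨ +-identityʳ _ ⟩
      K i j                          ∎
      where open ≈-Reasoning

    InMH⇒e*-annihilates : ∀ {u} → InMH u → (e*R ᵥ· u) ≈ᵥ 0ᵥ
    InMH⇒e*-annihilates {u} (ue≈0 , u-VH) j = begin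
      (e*R ᵥ· u) j                        ≈⟨ ᵥ·-cong reflᵥ (symₘ (⊗-1H ue≈0)) j ⟩
      (e*R ᵥ· (u ⊗ 1H)) j                 ≈⟨ ⟨⟩-cong reflᵥ (λ k → sym (Σ-idMʳ j ((u ⊗ 1H) k))) ⟩
      ⟨ e*R , (u ⊗ 1H) ·ᵥ col idM j ⟩     ≈⟨ ⟨⟩-cong reflᵥ (·ᵥ-assoc u 1H (col idM j)) ⟩
      ⟨ e*R , u ·ᵥ (1H ·ᵥ col idM j) ⟩    ≈⟨ u-VH _ (e*-annihilates⇒preserves-VH e*-ᵥ·-1H (col idM j)) ⟩
      0#                                  ∎
      where open ≈-Reasoning

    module Compression (τ : Mat) where

      τH : Mat
      τH = τ H

      -- M_{H,τ_H}(R); given e*e = 1, the condition e* K = 0 is equivalent to K preserving V_H.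
      InMHτH : Mat → Set ℓ
      InMHτH K = ((K ·ᵥ eR) ≈ᵥ 0ᵥ) × ((e*R ᵥ· K) ≈ᵥ 0ᵥ) × Commute K τH

      InMH⇒InMHτH : ∀ {u} → InMH u → Commute u τH → InMHτH u
      InMH⇒InMHτH u-MH uτH = proj₁ u-MH , InMH⇒e*-annihilates u-MH , uτH

      InMHτH⇒InMH : ∀ {u} → InMHτH u → InMH u
      InMHτH⇒InMH (ue≈0 , e*u≈0 , _) = ue≈0 , λ v _ → e*-annihilates⇒preserves-VH e*u≈0 v

      1H-idem : (1H ⊗ 1H) ≈ₘ 1H
      1H-idem = ⊗-1H 1H-·ᵥ-e

      InMHτH-1H : InMHτH 1H
      InMHτH-1H = 1H-·ᵥ-e , e*-ᵥ·-1H , (begin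
        1H ⊗ (1H ⊗ (τ ⊗ 1H))   ≈⟨ symₘ (⊗-assoc 1H 1H (τ ⊗ 1H)) ⟩
        (1H ⊗ 1H) ⊗ (τ ⊗ 1H)   ≈⟨ ⊗-cong 1H-idem reflₘ ⟩
        1H ⊗ (τ ⊗ 1H)          ≈⟨ ⊗-cong reflₘ (⊗-cong reflₘ (symₘ 1H-idem)) ⟩
        1H ⊗ (τ ⊗ (1H ⊗ 1H))   ≈⟨ ⊗-cong reflₘ (symₘ (⊗-assoc τ 1H 1H)) ⟩
        1H ⊗ ((τ ⊗ 1H) ⊗ 1H)   ≈⟨ symₘ (⊗-assoc 1H (τ ⊗ 1H) 1H) ⟩
        (1H ⊗ (τ ⊗ 1H)) ⊗ 1H   ∎)
        where open ≈ₘ-Reasoning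

      InMHτH-τH⊗ : ∀ {K} → InMHτH K → InMHτH (τH ⊗ K)
      InMHτH-τH⊗ {K} (Ke≈0 , e*K≈0 , KτH) =
        transᵥ (·ᵥ-assoc τH K eR) (transᵥ (·ᵥ-cong reflₘ Ke≈0) (·ᵥ-zeroʳ τH)) ,
        transᵥ (symᵥ (ᵥ·-assoc e*R τH K)) (transᵥ (ᵥ·-cong e*τH≈0 reflₘ) (ᵥ·-zeroˡ K)) ,
        symₘ (comm-⊗ reflₘ (symₘ KτH))
        where
        e*τH≈0 : (e*R ᵥ· τH) ≈ᵥ 0ᵥ
        e*τH≈0 = transᵥ (symᵥ (ᵥ·-assoc e*R 1H (τ ⊗ 1H)))
                        (transᵥ (ᵥ·-cong e*-ᵥ·-1H reflₘ) (ᵥ·-zeroˡ (τ ⊗ 1H)))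

      τ⊗-split : ∀ {K} → InMHτH K → (τ ⊗ K) ≈ₘ ((τH ⊗ K) +ₘ (E ⊗ (τ ⊗ K)))
      τ⊗-split {K} (_ , e*K≈0 , _) = begin
        τ ⊗ K                                   ≈⟨ symₘ (⊗-identityˡ _) ⟩
        idM ⊗ (τ ⊗ K)                           ≈⟨ ⊗-cong idM≈1H+E reflₘ ⟩
        (1H +ₘ E) ⊗ (τ ⊗ K)                     ≈⟨ ⊗-distribʳ-+ₘ _ 1H E ⟩
        (1H ⊗ (τ ⊗ K)) +ₘ (E ⊗ (τ ⊗ K))         ≈⟨ +ₘ-cong (⊗-cong reflₘ (⊗-cong reflₘ (symₘ (1H-⊗ e*K≈0)))) reflₘ ⟩
        (1H ⊗ (τ ⊗ (1H ⊗ K))) +ₘ (E ⊗ (τ ⊗ K))  ≈⟨ +ₘ-cong (⊗-cong reflₘ (symₘ (⊗-assoc τ 1H K))) reflₘ ⟩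
        (1H ⊗ ((τ ⊗ 1H) ⊗ K)) +ₘ (E ⊗ (τ ⊗ K))  ≈⟨ +ₘ-cong (symₘ (⊗-assoc 1H (τ ⊗ 1H) K)) reflₘ ⟩
        (τH ⊗ K) +ₘ (E ⊗ (τ ⊗ K))               ∎
        where open ≈ₘ-Reasoning

      ⊗τ-split : ∀ {K} → InMHτH K → (K ⊗ τ) ≈ₘ ((τH ⊗ K) +ₘ ((K ⊗ τ) ⊗ E))
      ⊗τ-split {K} (Ke≈0 , _ , KτH) = begin
        K ⊗ τ                                   ≈⟨ symₘ (⊗-identityʳ _) ⟩
        (K ⊗ τ) ⊗ idM                           ≈⟨ ⊗-cong reflₘ idM≈1H+E ⟩
        (K ⊗ τ) ⊗ (1H +ₘ E)                     ≈⟨ ⊗-distribˡ-+ₘ (K ⊗ τ) 1H E ⟩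
        ((K ⊗ τ) ⊗ 1H) +ₘ ((K ⊗ τ) ⊗ E)         ≈⟨ +ₘ-cong (⊗-assoc K τ 1H) reflₘ ⟩
        (K ⊗ (τ ⊗ 1H)) +ₘ ((K ⊗ τ) ⊗ E)         ≈⟨ +ₘ-cong (⊗-cong (symₘ (⊗-1H Ke≈0)) reflₘ) reflₘ ⟩
        ((K ⊗ 1H) ⊗ (τ ⊗ 1H)) +ₘ ((K ⊗ τ) ⊗ E)  ≈⟨ +ₘ-cong (⊗-assoc K 1H (τ ⊗ 1H)) reflₘ ⟩
        (K ⊗ τH) +ₘ ((K ⊗ τ) ⊗ E)               ≈⟨ +ₘ-cong KτH reflₘ ⟩
        (τH ⊗ K) +ₘ ((K ⊗ τ) ⊗ E)               ∎
        where open ≈ₘ-Reasoning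

      Φ-⊗τ : ∀ {K} → InMHτH K → ∀ X Y → Φ K (X ⊗ τ) Y ≈ Φ (τH ⊗ K) X Y + entry X * Φ K τ Y
      Φ-⊗τ {K} K∈ X Y = begin
        entry ((X ⊗ τ) ⊗ (K ⊗ Y))                               ≈⟨ entry-cong (transₘ (⊗-assoc X τ _)
                                                                     (⊗-cong reflₘ (symₘ (⊗-assoc τ K Y)))) ⟩
        entry (X ⊗ ((τ ⊗ K) ⊗ Y))                               ≈⟨ entry-cong (⊗-cong reflₘ (⊗-cong (τ⊗-split K∈) reflₘ)) ⟩
        entry (X ⊗ (((τH ⊗ K) +ₘ (E ⊗ (τ ⊗ K))) ⊗ Y))           ≈⟨ entry-cong (⊗-cong reflₘ (⊗-distribʳ-+ₘ Y _ _)) ⟩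
        entry (X ⊗ (((τH ⊗ K) ⊗ Y) +ₘ ((E ⊗ (τ ⊗ K)) ⊗ Y)))     ≈⟨ IsLinear.+-homo (IsLinear-∘⊗ˡ entry-linear X) _ _ ⟩
        entry (X ⊗ ((τH ⊗ K) ⊗ Y)) + entry (X ⊗ ((E ⊗ (τ ⊗ K)) ⊗ Y))
                                                                ≈⟨ +-cong refl
                                                                     (entry-cong (⊗-cong reflₘ (transₘ (⊗-assoc E (τ ⊗ K) Y)
                                                                       (⊗-cong reflₘ (⊗-assoc τ K Y))))) ⟩
        Φ (τH ⊗ K) X Y + entry (X ⊗ (E ⊗ (τ ⊗ (K ⊗ Y))))        ≈⟨ +-cong refl (entry-⊗E⊗ X _) ⟩
        Φ (τH ⊗ K) X Y + entry X * Φ K τ Y                      ∎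
        where open ≈-Reasoning

      Φ-τ⊗ : ∀ {K} → InMHτH K → ∀ X Y → Φ K X (τ ⊗ Y) ≈ Φ (τH ⊗ K) X Y + Φ K X τ * entry Y
      Φ-τ⊗ {K} K∈ X Y = begin
        entry (X ⊗ (K ⊗ (τ ⊗ Y)))                               ≈⟨ entry-cong (⊗-cong reflₘ (symₘ (⊗-assoc K τ Y))) ⟩
        entry (X ⊗ ((K ⊗ τ) ⊗ Y))                               ≈⟨ entry-cong (⊗-cong reflₘ (⊗-cong (⊗τ-split K∈) reflₘ)) ⟩
        entry (X ⊗ (((τH ⊗ K) +ₘ ((K ⊗ τ) ⊗ E)) ⊗ Y))           ≈⟨ entry-cong (⊗-cong reflₘ (⊗-distribʳ-+ₘ Y _ _)) ⟩
        entry (X ⊗ (((τH ⊗ K) ⊗ Y) +ₘ (((K ⊗ τ) ⊗ E) ⊗ Y)))     ≈⟨ IsLinear.+-homo (IsLinear-∘⊗ˡ entry-linear X) _ _ ⟩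
        entry (X ⊗ ((τH ⊗ K) ⊗ Y)) + entry (X ⊗ (((K ⊗ τ) ⊗ E) ⊗ Y))
                                                                ≈⟨ +-cong refl
                                                                     (entry-cong (transₘ (⊗-cong reflₘ (⊗-assoc (K ⊗ τ) E Y))
                                                                       (symₘ (⊗-assoc X (K ⊗ τ) (E ⊗ Y))))) ⟩
        Φ (τH ⊗ K) X Y + entry ((X ⊗ (K ⊗ τ)) ⊗ (E ⊗ Y))        ≈⟨ +-cong refl (entry-⊗E⊗ _ Y) ⟩
        Φ (τH ⊗ K) X Y + Φ K X τ * entry Y                      ∎
        where open ≈-Reasoning

      Φ-idMˡ : ∀ {K} → InMHτH K → ∀ Y → Φ K idM Y ≈ 0#
      Φ-idMˡ {K} (_ , e*K≈0 , _) Y = begin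
        entry (idM ⊗ (K ⊗ Y))         ≈⟨ entry-cong (⊗-identityˡ _) ⟩
        ⟨ e*R , (K ⊗ Y) ·ᵥ eR ⟩       ≈⟨ ⟨⟩-cong reflᵥ (·ᵥ-assoc K Y eR) ⟩
        ⟨ e*R , K ·ᵥ (Y ·ᵥ eR) ⟩      ≈⟨ e*-annihilates⇒preserves-VH e*K≈0 _ ⟩
        0#                            ∎
        where open ≈-Reasoning

      Φ-idMʳ : ∀ {K} → InMHτH K → ∀ X → Φ K X idM ≈ 0#
      Φ-idMʳ {K} (Ke≈0 , _ , _) X = begin
        entry (X ⊗ (K ⊗ idM))         ≈⟨ entry-cong (⊗-cong reflₘ (⊗-identityʳ K)) ⟩
        ⟨ e*R , (X ⊗ K) ·ᵥ eR ⟩       ≈⟨ ⟨⟩-cong reflᵥ (transᵥ (·ᵥ-assoc X K eR) (transᵥ (·ᵥ-cong reflₘ Ke≈0) (·ᵥ-zeroʳ X))) ⟩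
        ⟨ e*R , 0ᵥ ⟩                  ≈⟨ ⟨⟩-0ʳ e*R ⟩
        0#                            ∎
        where open ≈-Reasoning

      -- Peeling a τ off either side replaces K by τ_H K, so both inductions range over all of M_{H,τ_H}.
      Φ-sym-τ : ∀ {K} → InMHτH K → ∀ j → Φ K τ (τ ^ j) ≈ Φ K (τ ^ j) τ
      Φ-sym-τ K∈ zero    = trans (Φ-idMʳ K∈ τ) (sym (Φ-idMˡ K∈ τ))
      Φ-sym-τ {K} K∈ (suc j) = begin
        Φ K τ (τ ⊗ (τ ^ j))                           ≈⟨ Φ-τ⊗ K∈ τ (τ ^ j) ⟩
        Φ (τH ⊗ K) τ (τ ^ j) + Φ K τ τ * entry (τ ^ j) ≈⟨ +-cong (Φ-sym-τ (InMHτH-τH⊗ K∈) j) (*-comm _ _) ⟩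
        Φ (τH ⊗ K) (τ ^ j) τ + entry (τ ^ j) * Φ K τ τ ≈⟨ Φ-⊗τ K∈ (τ ^ j) τ ⟨
        Φ K ((τ ^ j) ⊗ τ) τ                           ≈⟨ Φ-cong reflₘ (^-suc-comm τ j) reflₘ ⟩
        Φ K (τ ^ suc j) τ                             ∎
        where open ≈-Reasoning

      Φ-sym-^ : ∀ {K} → InMHτH K → ∀ i j → Φ K (τ ^ i) (τ ^ j) ≈ Φ K (τ ^ j) (τ ^ i)
      Φ-sym-^ K∈ zero    j = trans (Φ-idMˡ K∈ (τ ^ j)) (sym (Φ-idMʳ K∈ (τ ^ j)))
      Φ-sym-^ {K} K∈ (suc i) j = begin
        Φ K (τ ^ suc i) (τ ^ j)                                ≈⟨ Φ-cong reflₘ (symₘ (^-suc-comm τ i)) reflₘ ⟩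
        Φ K ((τ ^ i) ⊗ τ) (τ ^ j)                              ≈⟨ Φ-⊗τ K∈ (τ ^ i) (τ ^ j) ⟩
        Φ (τH ⊗ K) (τ ^ i) (τ ^ j) + entry (τ ^ i) * Φ K τ (τ ^ j)
                                                               ≈⟨ +-cong (Φ-sym-^ (InMHτH-τH⊗ K∈) i j)
                                                                    (trans (*-comm _ _) (*-cong (Φ-sym-τ K∈ j) refl)) ⟩
        Φ (τH ⊗ K) (τ ^ j) (τ ^ i) + Φ K (τ ^ j) τ * entry (τ ^ i) ≈⟨ Φ-τ⊗ K∈ (τ ^ j) (τ ^ i) ⟨
        Φ K (τ ^ j) (τ ^ suc i)                                ∎
        where open ≈-Reasoning

      Φ-sym-poly : ∀ {K} → InMHτH K → ∀ p q → Φ K (poly p τ) (poly q τ) ≈ Φ K (poly q τ) (poly p τ)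
      Φ-sym-poly {K} K∈ p q =
        IsLinear-agree-poly (Φ-linearʳ K (poly p τ)) (Φ-linearˡ K (poly p τ)) sym-^-poly q
        where
        sym-^-poly : ∀ j → Φ K (poly p τ) (τ ^ j) ≈ Φ K (τ ^ j) (poly p τ)
        sym-^-poly j = IsLinear-agree-poly (Φ-linearˡ K (τ ^ j)) (Φ-linearʳ K (τ ^ j))
                                           (λ i → Φ-sym-^ K∈ i j) p

module Stability {c ℓ} (R : CommutativeRing c ℓ) (n : ℕ) (e e* : Fin n → ℤ) where
  open Hyperplane R n e e* public

  ·ᵥ-col-idM : ∀ x j → (x ·ᵥ col idM j) ≈ᵥ col x j
  ·ᵥ-col-idM x j i = Σ-idMʳ j (x i)

  idM-row-ᵥ· : ∀ x i → (idM i ᵥ· x) ≈ᵥ x i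
  idM-row-ᵥ· x i j = Σ-idMˡ i (col x j)

  module StableEndomorphism (e*e≈1 : ⟨ e*R , eR ⟩ ≈ 1#) (τ : Mat) (stab : Stable τ) where
    open Normalised e*e≈1 public
    open Compression τ public

    poly-Mτ : ∀ p → Commute (poly p τ) τ
    poly-Mτ p = symₘ (comm-poly reflₘ p)

    Mτ-agree-·e⇒agree : ∀ {x y} → Commute x τ → Commute y τ → (x ·ᵥ eR) ≈ᵥ (y ·ᵥ eR) →
      ∀ v → (x ·ᵥ v) ≈ᵥ (y ·ᵥ v)
    Mτ-agree-·e⇒agree {x} {y} xτ yτ xe≈ye v = begin
      x ·ᵥ v            ≈⟨ ·ᵥ-cong reflₘ Pe≈v ⟨
      x ·ᵥ (P ·ᵥ eR)    ≈⟨ ·ᵥ-assoc x P eR ⟨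
      (x ⊗ P) ·ᵥ eR     ≈⟨ ·ᵥ-cong (comm-poly xτ p) reflᵥ ⟩
      (P ⊗ x) ·ᵥ eR     ≈⟨ ·ᵥ-assoc P x eR ⟩
      P ·ᵥ (x ·ᵥ eR)    ≈⟨ ·ᵥ-cong reflₘ xe≈ye ⟩
      P ·ᵥ (y ·ᵥ eR)    ≈⟨ ·ᵥ-assoc P y eR ⟨
      (P ⊗ y) ·ᵥ eR     ≈⟨ ·ᵥ-cong (comm-poly yτ p) reflᵥ ⟨
      (y ⊗ P) ·ᵥ eR     ≈⟨ ·ᵥ-assoc y P eR ⟩
      y ·ᵥ (P ·ᵥ eR)    ≈⟨ ·ᵥ-cong reflₘ Pe≈v ⟩
      y ·ᵥ v            ∎
      where
      open ≈ᵥ-Reasoning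
      p = proj₁ (proj₁ stab v)
      P = poly p τ
      Pe≈v = proj₂ (proj₁ stab v)

    Mτ-agree-e*·⇒agree : ∀ {x y} → Commute x τ → Commute y τ → (e*R ᵥ· x) ≈ᵥ (e*R ᵥ· y) →
      ∀ l → (l ᵥ· x) ≈ᵥ (l ᵥ· y)
    Mτ-agree-e*·⇒agree {x} {y} xτ yτ e*x≈e*y l = begin
      l ᵥ· x              ≈⟨ ᵥ·-cong e*Q≈l reflₘ ⟨
      (e*R ᵥ· Q) ᵥ· x     ≈⟨ ᵥ·-assoc e*R Q x ⟩
      e*R ᵥ· (Q ⊗ x)      ≈⟨ ᵥ·-cong reflᵥ (comm-poly xτ q) ⟨
      e*R ᵥ· (x ⊗ Q)      ≈⟨ ᵥ·-assoc e*R x Q ⟨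
      (e*R ᵥ· x) ᵥ· Q     ≈⟨ ᵥ·-cong e*x≈e*y reflₘ ⟩
      (e*R ᵥ· y) ᵥ· Q     ≈⟨ ᵥ·-assoc e*R y Q ⟩
      e*R ᵥ· (y ⊗ Q)      ≈⟨ ᵥ·-cong reflᵥ (comm-poly yτ q) ⟩
      e*R ᵥ· (Q ⊗ y)      ≈⟨ ᵥ·-assoc e*R Q y ⟨
      (e*R ᵥ· Q) ᵥ· y     ≈⟨ ᵥ·-cong e*Q≈l reflₘ ⟩
      l ᵥ· y              ∎
      where
      open ≈ᵥ-Reasoning
      q = proj₁ (proj₂ stab l)
      Q = poly q τ
      e*Q≈l = proj₂ (proj₂ stab l)

    Mτ-determined-by-·e : ∀ {x y} → Commute x τ → Commute y τ → (x ·ᵥ eR) ≈ᵥ (y ·ᵥ eR) → x ≈ₘ y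
    Mτ-determined-by-·e {x} {y} xτ yτ xe≈ye i j =
      trans (sym (·ᵥ-col-idM x j i))
            (trans (Mτ-agree-·e⇒agree xτ yτ xe≈ye (col idM j) i) (·ᵥ-col-idM y j i))

    Mτ-determined-by-e*· : ∀ {x y} → Commute x τ → Commute y τ → (e*R ᵥ· x) ≈ᵥ (e*R ᵥ· y) → x ≈ₘ y
    Mτ-determined-by-e*· {x} {y} xτ yτ e*x≈e*y i j =
      trans (sym (idM-row-ᵥ· x i j))
            (trans (Mτ-agree-e*·⇒agree xτ yτ e*x≈e*y (idM i) j) (idM-row-ᵥ· y i j))

    Mτ⊆R[τ] : ∀ {x} → Commute x τ → ∃ λ p → x ≈ₘ poly p τ
    Mτ⊆R[τ] {x} xτ = p , Mτ-determined-by-·e xτ (poly-Mτ p) (symᵥ Pe≈xe)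
      where
      p = proj₁ (proj₁ stab (x ·ᵥ eR))
      Pe≈xe = proj₂ (proj₁ stab (x ·ᵥ eR))

    Mτ-commutative : ∀ {X Y} → Commute X τ → Commute Y τ → Commute X Y
    Mτ-commutative {X} {Y} Xτ Yτ =
      transₘ (⊗-cong reflₘ Y≈Q) (transₘ (comm-poly Xτ q) (⊗-cong (symₘ Y≈Q) reflₘ))
      where
      q = proj₁ (Mτ⊆R[τ] Yτ)
      Y≈Q = proj₂ (Mτ⊆R[τ] Yτ)

    Φ-sym : ∀ {K X Y} → InMHτH K → Commute X τ → Commute Y τ → Φ K X Y ≈ Φ K Y X
    Φ-sym {K} K∈ Xτ Yτ = begin
      Φ K _ _          ≈⟨ Φ-cong reflₘ X≈P Y≈Q ⟩
      Φ K P Q          ≈⟨ Φ-sym-poly K∈ p q ⟩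
      Φ K Q P          ≈⟨ Φ-cong reflₘ Y≈Q X≈P ⟨
      Φ K _ _          ∎
      where
      open ≈-Reasoning
      p = proj₁ (Mτ⊆R[τ] Xτ)
      X≈P = proj₂ (Mτ⊆R[τ] Xτ)
      q = proj₁ (Mτ⊆R[τ] Yτ)
      Y≈Q = proj₂ (Mτ⊆R[τ] Yτ)
      P = poly p τ
      Q = poly q τ

    annihilated-by-e*R[τ]⇒0 : ∀ {z} → (∀ q → ⟨ e*R , poly q τ ·ᵥ z ⟩ ≈ 0#) → z ≈ᵥ 0ᵥ
    annihilated-by-e*R[τ]⇒0 {z} e*Qz≈0 i = begin
      z i                        ≈⟨ Σ-idMˡ i z ⟨
      ⟨ idM i , z ⟩              ≈⟨ ⟨⟩-cong e*Q≈row reflᵥ ⟨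
      ⟨ e*R ᵥ· poly q τ , z ⟩    ≈⟨ ⟨⟩-assoc e*R (poly q τ) z ⟩
      ⟨ e*R , poly q τ ·ᵥ z ⟩    ≈⟨ e*Qz≈0 q ⟩
      0#                         ∎
      where
      open ≈-Reasoning
      q = proj₁ (proj₂ stab (idM i))
      e*Q≈row = proj₂ (proj₂ stab (idM i))

    covectors-agree-on-R[τ]e : ∀ {l m} → (∀ p → ⟨ l , poly p τ ·ᵥ eR ⟩ ≈ ⟨ m , poly p τ ·ᵥ eR ⟩) → l ≈ᵥ m
    covectors-agree-on-R[τ]e {l} {m} l≈m j = begin
      l j                        ≈⟨ Σ-idMʳ j l ⟨
      ⟨ l , col idM j ⟩          ≈⟨ ⟨⟩-cong reflᵥ Pe≈col ⟨
      ⟨ l , poly p τ ·ᵥ eR ⟩     ≈⟨ l≈m p ⟩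
      ⟨ m , poly p τ ·ᵥ eR ⟩     ≈⟨ ⟨⟩-cong reflᵥ Pe≈col ⟩
      ⟨ m , col idM j ⟩          ≈⟨ Σ-idMʳ j m ⟩
      m j                        ∎
      where
      open ≈-Reasoning
      p = proj₁ (proj₁ stab (col idM j))
      Pe≈col = proj₂ (proj₁ stab (col idM j))

    0ₘ-Mτ : Commute 0ₘ τ
    0ₘ-Mτ = transₘ (⊗-zeroˡ τ) (symₘ (⊗-zeroʳ τ))

    -- τ^j L splits into τ_H-terms and multiples of e e*, so e* τ^j L (D e) = 0 for all j and L.
    τ^⊗-kills : ∀ {D} → (∀ {L} → InMHτH L → entry ((τ ⊗ L) ⊗ D) ≈ 0#) →
      ∀ j {L} → InMHτH L → entry (((τ ^ j) ⊗ L) ⊗ D) ≈ 0#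
    τ^⊗-kills {D} τLD≈0 zero {L} (_ , e*L≈0 , _) = begin
      entry ((idM ⊗ L) ⊗ D)       ≈⟨ entry-cong (⊗-cong (⊗-identityˡ L) reflₘ) ⟩
      ⟨ e*R , (L ⊗ D) ·ᵥ eR ⟩     ≈⟨ ⟨⟩-cong reflᵥ (·ᵥ-assoc L D eR) ⟩
      ⟨ e*R , L ·ᵥ (D ·ᵥ eR) ⟩    ≈⟨ e*-annihilates⇒preserves-VH e*L≈0 _ ⟩
      0#                          ∎
      where open ≈-Reasoning
    τ^⊗-kills {D} τLD≈0 (suc j) {L} L∈ = begin
      entry (((τ ^ suc j) ⊗ L) ⊗ D)              ≈⟨ entry-cong (⊗-cong (transₘ (⊗-cong (symₘ (^-suc-comm τ j)) reflₘ)
                                                                          (⊗-assoc (τ ^ j) τ L)) reflₘ) ⟩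
      G (τ ⊗ L)                                  ≈⟨ G.cong (τ⊗-split L∈) ⟩
      G ((τH ⊗ L) +ₘ (E ⊗ (τ ⊗ L)))              ≈⟨ G.+-homo _ _ ⟩
      G (τH ⊗ L) + G (E ⊗ (τ ⊗ L))               ≈⟨ +-cong (τ^⊗-kills τLD≈0 j (InMHτH-τH⊗ L∈)) (entry-cong
                                                      (transₘ (⊗-assoc _ _ D) (⊗-cong reflₘ (⊗-assoc E _ D)))) ⟩
      0# + entry ((τ ^ j) ⊗ (E ⊗ ((τ ⊗ L) ⊗ D))) ≈⟨ +-cong refl (entry-⊗E⊗ (τ ^ j) _) ⟩
      0# + entry (τ ^ j) * entry ((τ ⊗ L) ⊗ D)   ≈⟨ +-cong refl (*-cong refl (τLD≈0 L∈)) ⟩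
      0# + entry (τ ^ j) * 0#                    ≈⟨ trans (+-identityˡ _) (zeroʳ _) ⟩
      0#                                         ∎
      where
      open ≈-Reasoning
      G : Mat → Carrier
      G X = entry (((τ ^ j) ⊗ X) ⊗ D)
      module G = IsLinear (IsLinear-∘⊗ˡ (IsLinear-∘⊗ʳ entry-linear D) (τ ^ j))

    Mτ-separated : ∀ {D} → Commute D τ → entry D ≈ 0# →
      (∀ {L} → InMHτH L → entry ((τ ⊗ L) ⊗ D) ≈ 0#) → D ≈ₘ 0ₘ
    Mτ-separated {D} Dτ entryD≈0 τLD≈0 =
      Mτ-determined-by-·e Dτ 0ₘ-Mτ (transᵥ De≈0 (symᵥ (·ᵥ-zeroˡ eR)))
      where
      F : Mat → Carrier
      F X = entry (X ⊗ D)

      F-⊗1H : ∀ X → F (X ⊗ 1H) ≈ F X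
      F-⊗1H X = ⟨⟩-cong reflᵥ (transᵥ (·ᵥ-assoc (X ⊗ 1H) D eR) (transᵥ (·ᵥ-assoc X 1H _)
                  (transᵥ (·ᵥ-cong reflₘ (1H-·ᵥ-VH entryD≈0)) (symᵥ (·ᵥ-assoc X D eR)))))

      F-poly : ∀ q → F (poly q τ) ≈ 0#
      F-poly = IsLinear-agree-poly (IsLinear-∘⊗ʳ entry-linear D) IsLinear-0
                 (λ j → trans (sym (F-⊗1H (τ ^ j))) (τ^⊗-kills τLD≈0 j InMHτH-1H))

      De≈0 : (D ·ᵥ eR) ≈ᵥ 0ᵥ
      De≈0 = annihilated-by-e*R[τ]⇒0 (λ q →
               trans (⟨⟩-cong reflᵥ (symᵥ (·ᵥ-assoc (poly q τ) D eR))) (F-poly q))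

    Balanced : Mat → Set (c ⊔ ℓ)
    Balanced w = ∀ {X} → Commute X τ → entry (X ⊗ w) ≈ entry (w ⊗ X)

    -- In the paper's notation k = [•e]⁻¹(w e) = [e*•]⁻¹(e* w); for w = a u a⁻¹ this is μ(u) = ν(u) = k.
    Represents : Mat → Mat → Set ℓ
    Represents k w = Commute k τ × ((k ·ᵥ eR) ≈ᵥ (w ·ᵥ eR)) × ((e*R ᵥ· k) ≈ᵥ (e*R ᵥ· w))

    μ≡ν-at : Mat → Set (c ⊔ ℓ)
    μ≡ν-at w = ∀ x x' → IsInvCo τ x (e*R ᵥ· w) → IsInvV τ x' (w ·ᵥ eR) → x ≈ₘ x'

    μ≡ν-at⇒represented : ∀ {w} → μ≡ν-at w → ∃ λ k → Represents k w
    μ≡ν-at⇒represented {w} μ≡ν =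
      P , poly-Mτ p , Pe≈we , transᵥ (ᵥ·-cong reflᵥ (symₘ Q≈P)) e*Q≈e*w
      where
      p = proj₁ (proj₁ stab (w ·ᵥ eR))
      Pe≈we = proj₂ (proj₁ stab (w ·ᵥ eR))
      P = poly p τ
      q = proj₁ (proj₂ stab (e*R ᵥ· w))
      e*Q≈e*w = proj₂ (proj₂ stab (e*R ᵥ· w))
      Q≈P : poly q τ ≈ₘ P
      Q≈P = μ≡ν (poly q τ) P (poly-Mτ q , e*Q≈e*w) (poly-Mτ p , Pe≈we)

    represented⇒μ≡ν-at : ∀ {k w} → Represents k w → μ≡ν-at w
    represented⇒μ≡ν-at (kτ , ke≈we , e*k≈e*w) x x' (xτ , e*x≈e*w) (x'τ , x'e≈we) =
      transₘ (Mτ-determined-by-e*· xτ kτ (transᵥ e*x≈e*w (symᵥ e*k≈e*w)))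
             (Mτ-determined-by-·e kτ x'τ (transᵥ ke≈we (symᵥ x'e≈we)))

    represented⇒balanced : ∀ {k w} → Represents k w → Balanced w
    represented⇒balanced {k} {w} (kτ , ke≈we , e*k≈e*w) {X} Xτ = begin
      ⟨ e*R , (X ⊗ w) ·ᵥ eR ⟩     ≈⟨ ⟨⟩-cong reflᵥ (·ᵥ-assoc X w eR) ⟩
      ⟨ e*R , X ·ᵥ (w ·ᵥ eR) ⟩    ≈⟨ ⟨⟩-cong reflᵥ (·ᵥ-cong reflₘ (symᵥ ke≈we)) ⟩
      ⟨ e*R , X ·ᵥ (k ·ᵥ eR) ⟩    ≈⟨ ⟨⟩-cong reflᵥ (symᵥ (·ᵥ-assoc X k eR)) ⟩
      entry (X ⊗ k)               ≈⟨ entry-cong (Mτ-commutative Xτ kτ) ⟩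
      ⟨ e*R , (k ⊗ X) ·ᵥ eR ⟩     ≈⟨ ⟨⟩-cong reflᵥ (·ᵥ-assoc k X eR) ⟩
      ⟨ e*R , k ·ᵥ (X ·ᵥ eR) ⟩    ≈⟨ ⟨⟩-assoc e*R k _ ⟨
      ⟨ e*R ᵥ· k , X ·ᵥ eR ⟩      ≈⟨ ⟨⟩-cong e*k≈e*w reflᵥ ⟩
      ⟨ e*R ᵥ· w , X ·ᵥ eR ⟩      ≈⟨ ⟨⟩-assoc e*R w _ ⟩
      ⟨ e*R , w ·ᵥ (X ·ᵥ eR) ⟩    ≈⟨ ⟨⟩-cong reflᵥ (symᵥ (·ᵥ-assoc w X eR)) ⟩
      entry (w ⊗ X)               ∎
      where open ≈-Reasoning

    balanced⇒represented : ∀ {w} → Balanced w → ∃ λ k → Represents k w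
    balanced⇒represented {w} w-bal = P , poly-Mτ p , Pe≈we , covectors-agree-on-R[τ]e e*P≈e*w
      where
      p = proj₁ (proj₁ stab (w ·ᵥ eR))
      Pe≈we = proj₂ (proj₁ stab (w ·ᵥ eR))
      P = poly p τ
      e*P≈e*w : ∀ q → ⟨ e*R ᵥ· P , poly q τ ·ᵥ eR ⟩ ≈ ⟨ e*R ᵥ· w , poly q τ ·ᵥ eR ⟩
      e*P≈e*w q = begin
        ⟨ e*R ᵥ· P , Q ·ᵥ eR ⟩      ≈⟨ ⟨⟩-assoc e*R P _ ⟩
        ⟨ e*R , P ·ᵥ (Q ·ᵥ eR) ⟩    ≈⟨ ⟨⟩-cong reflᵥ (symᵥ (·ᵥ-assoc P Q eR)) ⟩
        entry (P ⊗ Q)               ≈⟨ entry-cong (Mτ-commutative (poly-Mτ p) (poly-Mτ q)) ⟩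
        ⟨ e*R , (Q ⊗ P) ·ᵥ eR ⟩     ≈⟨ ⟨⟩-cong reflᵥ (transᵥ (·ᵥ-assoc Q P eR) (·ᵥ-cong reflₘ Pe≈we)) ⟩
        ⟨ e*R , Q ·ᵥ (w ·ᵥ eR) ⟩    ≈⟨ ⟨⟩-cong reflᵥ (symᵥ (·ᵥ-assoc Q w eR)) ⟩
        entry (Q ⊗ w)               ≈⟨ w-bal (poly-Mτ q) ⟩
        ⟨ e*R , (w ⊗ Q) ·ᵥ eR ⟩     ≈⟨ ⟨⟩-cong reflᵥ (·ᵥ-assoc w Q eR) ⟩
        ⟨ e*R , w ·ᵥ (Q ·ᵥ eR) ⟩    ≈⟨ ⟨⟩-assoc e*R w _ ⟨
        ⟨ e*R ᵥ· w , Q ·ᵥ eR ⟩      ∎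
        where
        open ≈-Reasoning
        Q = poly q τ

    Mτ-⊗ : ∀ {X Y} → Commute X τ → Commute Y τ → Commute (X ⊗ Y) τ
    Mτ-⊗ Xτ Yτ = symₘ (comm-⊗ (symₘ Xτ) (symₘ Yτ))

    entry-idM : entry idM ≈ 1#
    entry-idM = trans (⟨⟩-cong reflᵥ (·ᵥ-identity eR)) e*e≈1

    scalar-inverse⇒scalar : ∀ {b M} → (b ∙ₘ M) ≈ₘ idM → (entry M * b ≈ 1#) × (M ≈ₘ (entry M ∙ₘ idM))
    scalar-inverse⇒scalar {b} {M} bM≈1 = rb≈1 , (begin
      M                          ≈⟨ (λ i j → *-identityˡ (M i j)) ⟨
      1# ∙ₘ M                    ≈⟨ ∙ₘ-cong (sym rb≈1) reflₘ ⟩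
      (entry M * b) ∙ₘ M         ≈⟨ (λ i j → *-assoc (entry M) b (M i j)) ⟩
      entry M ∙ₘ (b ∙ₘ M)        ≈⟨ ∙ₘ-cong refl bM≈1 ⟩
      entry M ∙ₘ idM             ∎)
      where
      open ≈ₘ-Reasoning
      rb≈1 : entry M * b ≈ 1#
      rb≈1 = trans (*-comm _ _) (trans (sym (IsLinear.∙-homo entry-linear b M))
                                       (trans (entry-cong bM≈1) entry-idM))

    module Conjugation (a a⁻¹ : Mat) (inv : IsInv a a⁻¹) (aτ : Commute a τ) where

      a⁻¹τ : Commute a⁻¹ τ
      a⁻¹τ = comm-inverse inv aτ

      W : Mat → Mat
      W u = a ⊗ (u ⊗ a⁻¹)

      entry-⊗W : ∀ X u → entry (X ⊗ W u) ≈ Φ u (X ⊗ a) a⁻¹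
      entry-⊗W X u = entry-cong (symₘ (⊗-assoc X a (u ⊗ a⁻¹)))

      entry-W⊗ : ∀ X u → entry (W u ⊗ X) ≈ Φ u a (a⁻¹ ⊗ X)
      entry-W⊗ X u = entry-cong (transₘ (⊗-assoc a (u ⊗ a⁻¹) X) (⊗-cong reflₘ (⊗-assoc u a⁻¹ X)))

      twisted-symmetry : ∀ {L X} → InMHτH L → Balanced (W L) → Commute X τ →
        Φ L (a ⊗ X) a⁻¹ ≈ Φ L (a⁻¹ ⊗ X) a
      twisted-symmetry {L} {X} L∈ WL-bal Xτ = begin
        Φ L (a ⊗ X) a⁻¹        ≈⟨ Φ-cong reflₘ (Mτ-commutative aτ Xτ) reflₘ ⟩
        Φ L (X ⊗ a) a⁻¹        ≈⟨ entry-⊗W X L ⟨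
        entry (X ⊗ W L)        ≈⟨ WL-bal Xτ ⟩
        entry (W L ⊗ X)        ≈⟨ entry-W⊗ X L ⟩
        Φ L a (a⁻¹ ⊗ X)        ≈⟨ Φ-sym L∈ aτ (Mτ-⊗ a⁻¹τ Xτ) ⟩
        Φ L (a⁻¹ ⊗ X) a        ∎
        where open ≈-Reasoning

      μ≡ν⇒W-balanced : Setup.μ≡ν R n e e* τ a a⁻¹ → ∀ {L} → InMHτH L → Balanced (W L)
      μ≡ν⇒W-balanced μ≡ν {L} L∈@(_ , _ , LτH) =
        represented⇒balanced (proj₂ (μ≡ν-at⇒represented (μ≡ν L (InMHτH⇒InMH L∈) LτH)))

      W-balanced⇒μ≡ν : (∀ {L} → InMHτH L → Balanced (W L)) → Setup.μ≡ν R n e e* τ a a⁻¹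
      W-balanced⇒μ≡ν W-bal u u∈ uτH =
        represented⇒μ≡ν-at (proj₂ (balanced⇒represented (W-bal (InMH⇒InMHτH u∈ uτH))))

      A B : Mat → Carrier
      A X = entry (a ⊗ X)
      B X = entry (a⁻¹ ⊗ X)

      defect : Mat → Mat
      defect X = (A X ∙ₘ a⁻¹) -ₘ (B X ∙ₘ a)

      defect-Mτ : ∀ X → Commute (defect X) τ
      defect-Mτ X = symₘ (comm--ₘ (comm-∙ₘ (A X) (symₘ a⁻¹τ)) (comm-∙ₘ (B X) (symₘ aτ)))

      conj-cancel : ∀ {x y X} → (x ⊗ y) ≈ₘ idM → Commute X x → ((x ⊗ X) ⊗ y) ≈ₘ X
      conj-cancel {x} {y} {X} xy≈1 Xx = begin
        (x ⊗ X) ⊗ y     ≈⟨ ⊗-cong (symₘ Xx) reflₘ ⟩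
        (X ⊗ x) ⊗ y     ≈⟨ ⊗-assoc X x y ⟩
        X ⊗ (x ⊗ y)     ≈⟨ ⊗-cong reflₘ xy≈1 ⟩
        X ⊗ idM         ≈⟨ ⊗-identityʳ X ⟩
        X               ∎
        where open ≈ₘ-Reasoning

      module FromBalance (W-bal : ∀ {L} → InMHτH L → Balanced (W L)) where

        entry-defect : ∀ {X} → Commute X τ → entry (defect X) ≈ 0#
        entry-defect {X} Xτ = trans (combination-homo entry-linear (A X) a⁻¹ (B X) a) (x≈y⇒x∙y⁻¹≈ε e*-part)
          where
          same : entry ((a ⊗ X) ⊗ a⁻¹) ≈ entry ((a⁻¹ ⊗ X) ⊗ a)
          same = entry-cong (transₘ (conj-cancel (proj₁ inv) (Mτ-commutative Xτ aτ))
                                    (symₘ (conj-cancel (proj₂ inv) (Mτ-commutative Xτ a⁻¹τ))))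
          e*-part : A X * entry a⁻¹ ≈ B X * entry a
          e*-part = +-cancel-common (entry-⊗-split (a ⊗ X) a⁻¹) (entry-⊗-split (a⁻¹ ⊗ X) a)
                      same (twisted-symmetry InMHτH-1H (W-bal InMHτH-1H) Xτ)

        -- Φ-⊗τ peels the τ off both sides; twisted symmetry at L and at τ_H L cancels all but the A, B terms.
        τL-defect : ∀ {X L} → Commute X τ → InMHτH L → entry ((τ ⊗ L) ⊗ defect X) ≈ 0#
        τL-defect {X} {L} Xτ L∈ =
          trans (combination-homo (IsLinear-∘⊗ˡ entry-linear (τ ⊗ L)) (A X) a⁻¹ (B X) a)
                (x≈y⇒x∙y⁻¹≈ε (trans (*-cong refl (τL≈Φ a⁻¹)) (trans ψ-part (*-cong refl (sym (τL≈Φ a))))))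
          where
          τL≈Φ : ∀ Y → entry ((τ ⊗ L) ⊗ Y) ≈ Φ L τ Y
          τL≈Φ Y = entry-cong (⊗-assoc τ L Y)
          shifted : Φ L ((a ⊗ X) ⊗ τ) a⁻¹ ≈ Φ L ((a⁻¹ ⊗ X) ⊗ τ) a
          shifted = trans (Φ-cong reflₘ (⊗-assoc a X τ) reflₘ)
                   (trans (twisted-symmetry L∈ (W-bal L∈) (Mτ-⊗ Xτ reflₘ))
                          (Φ-cong reflₘ (symₘ (⊗-assoc a⁻¹ X τ)) reflₘ))
          ψ-part : A X * Φ L τ a⁻¹ ≈ B X * Φ L τ a
          ψ-part = +-cancel-common (Φ-⊗τ L∈ (a ⊗ X) a⁻¹) (Φ-⊗τ L∈ (a⁻¹ ⊗ X) a) shifted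
                     (twisted-symmetry (InMHτH-τH⊗ L∈) (W-bal (InMHτH-τH⊗ L∈)) Xτ)

        Aⱼa⁻¹≈Bⱼa : Setup.AB R n e e* τ a a⁻¹
        Aⱼa⁻¹≈Bⱼa j i k = x∙y⁻¹≈ε⇒x≈y _ _ (Mτ-separated (defect-Mτ (τ ^ j)) (entry-defect τ^jτ) (τL-defect τ^jτ) i k)
          where
          τ^jτ : Commute (τ ^ j) τ
          τ^jτ = symₘ (comm-^ reflₘ j)

      -- A P ≈ 1# for the P ∈ R[τ] with P e = a⁻¹ e, and (iii) extends linearly from the τ ^ j to P.
      AB⇒a⁻¹-scalar : Setup.AB R n e e* τ a a⁻¹ → ∃ λ b → a⁻¹ ≈ₘ (b ∙ₘ a)
      AB⇒a⁻¹-scalar ab = B P , λ i k → begin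
        a⁻¹ i k               ≈⟨ *-identityˡ _ ⟨
        1# * a⁻¹ i k          ≈⟨ *-cong AP≈1 refl ⟨
        A P * a⁻¹ i k         ≈⟨ IsLinear-agree-poly (IsLinear-*ʳ (IsLinear-∘⊗ˡ entry-linear a) (a⁻¹ i k))
                                   (IsLinear-*ʳ (IsLinear-∘⊗ˡ entry-linear a⁻¹) (a i k)) (λ j → ab j i k) p ⟩
        B P * a i k           ∎
        where
        open ≈-Reasoning
        p = proj₁ (proj₁ stab (a⁻¹ ·ᵥ eR))
        Pe≈a⁻¹e = proj₂ (proj₁ stab (a⁻¹ ·ᵥ eR))
        P = poly p τ
        AP≈1 : A P ≈ 1#
        AP≈1 = trans (⟨⟩-cong reflᵥ (transᵥ (·ᵥ-assoc a P eR) (transᵥ (·ᵥ-cong reflₘ Pe≈a⁻¹e)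
                       (symᵥ (·ᵥ-assoc a a⁻¹ eR)))))
                     (trans (entry-cong (proj₁ inv)) entry-idM)

      a⁻¹-scalar⇒a²-central : ∀ {b} → a⁻¹ ≈ₘ (b ∙ₘ a) → Setup.SqCentral R n e e* a
      a⁻¹-scalar⇒a²-central {b} a⁻¹≈ba = entry (a ⊗ a) , (b , proj₁ central) , proj₂ central
        where
        b-aa≈1 : (b ∙ₘ (a ⊗ a)) ≈ₘ idM
        b-aa≈1 = transₘ (symₘ (⊗-∙ₘˡ b a a)) (transₘ (⊗-cong (symₘ a⁻¹≈ba) reflₘ) (proj₂ inv))
        central = scalar-inverse⇒scalar b-aa≈1

      a²-central⇒a⁻¹-scalar : Setup.SqCentral R n e e* a → ∃ λ s → a⁻¹ ≈ₘ (s ∙ₘ a)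
      a²-central⇒a⁻¹-scalar (r , (s , rs≈1) , aa≈r) = s , symₘ (begin
        s ∙ₘ a                       ≈⟨ ∙ₘ-cong refl (symₘ (⊗-identityʳ a)) ⟩
        s ∙ₘ (a ⊗ idM)               ≈⟨ ∙ₘ-cong refl (⊗-cong reflₘ (symₘ (proj₁ inv))) ⟩
        s ∙ₘ (a ⊗ (a ⊗ a⁻¹))         ≈⟨ ∙ₘ-cong refl (symₘ (⊗-assoc a a a⁻¹)) ⟩
        s ∙ₘ ((a ⊗ a) ⊗ a⁻¹)         ≈⟨ ∙ₘ-cong refl (⊗-cong aa≈r reflₘ) ⟩
        s ∙ₘ ((r ∙ₘ idM) ⊗ a⁻¹)      ≈⟨ ∙ₘ-cong refl (transₘ (⊗-∙ₘˡ r idM a⁻¹) (∙ₘ-cong refl (⊗-identityˡ a⁻¹))) ⟩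
        s ∙ₘ (r ∙ₘ a⁻¹)              ≈⟨ (λ i j → sym (*-assoc s r (a⁻¹ i j))) ⟩
        (s * r) ∙ₘ a⁻¹               ≈⟨ ∙ₘ-cong (trans (*-comm s r) rs≈1) reflₘ ⟩
        1# ∙ₘ a⁻¹                    ≈⟨ (λ i j → *-identityˡ (a⁻¹ i j)) ⟩
        a⁻¹                          ∎)
        where open ≈ₘ-Reasoning

      a⁻¹-scalar⇒W-balanced : ∀ {s} → a⁻¹ ≈ₘ (s ∙ₘ a) → ∀ {u} → InMHτH u → Balanced (W u)
      a⁻¹-scalar⇒W-balanced {s} a⁻¹≈sa {u} u∈ {X} Xτ = begin
        entry (X ⊗ W u)          ≈⟨ entry-⊗W X u ⟩
        Φ u (X ⊗ a) a⁻¹          ≈⟨ Φ-cong reflₘ reflₘ a⁻¹≈sa ⟩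
        Φ u (X ⊗ a) (s ∙ₘ a)     ≈⟨ IsLinear.∙-homo (Φ-linearʳ u (X ⊗ a)) s a ⟩
        s * Φ u (X ⊗ a) a        ≈⟨ *-cong refl (Φ-sym u∈ (Mτ-⊗ Xτ aτ) aτ) ⟩
        s * Φ u a (X ⊗ a)        ≈⟨ *-cong refl (Φ-cong reflₘ reflₘ (Mτ-commutative Xτ aτ)) ⟩
        s * Φ u a (a ⊗ X)        ≈⟨ IsLinear.∙-homo (Φ-linearʳ u a) s (a ⊗ X) ⟨
        Φ u a (s ∙ₘ (a ⊗ X))     ≈⟨ Φ-cong reflₘ reflₘ (transₘ (symₘ (⊗-∙ₘˡ s a X)) (⊗-cong (symₘ a⁻¹≈sa) reflₘ)) ⟩
        Φ u a (a⁻¹ ⊗ X)          ≈⟨ entry-W⊗ X u ⟨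
        entry (W u ⊗ X)          ∎
        where open ≈-Reasoning

module DualNumbers {c ℓ} (R : CommutativeRing c ℓ) (n : ℕ) (e e* : Fin n → ℤ) where
  open Stability R n e e* public
  module D = Lin (Dual rawRing) n e e*
  open Setup R n e e* public using (base)

  infixl 6 _+ε_

  _+ε_ : Mat → Mat → D.Mat
  (x +ε y) i j = x i j , y i j

  π₀ π₁ : D.Mat → Mat
  π₀ X i j = proj₁ (X i j)
  π₁ X i j = proj₂ (X i j)

  v₀ v₁ : D.Vec → Vec
  v₀ v i = proj₁ (v i)
  v₁ v i = proj₂ (v i)

  lift : Vec → D.Vec
  lift v i = v i , 0#

  ≈ₘ-+ε : ∀ {X Y} → π₀ X ≈ₘ π₀ Y → π₁ X ≈ₘ π₁ Y → X D.≈ₘ Y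
  ≈ₘ-+ε p q i j = p i j , q i j

  ≈ₘ-π₀ : ∀ {X Y} → X D.≈ₘ Y → π₀ X ≈ₘ π₀ Y
  ≈ₘ-π₀ p i j = proj₁ (p i j)

  ≈ₘ-π₁ : ∀ {X Y} → X D.≈ₘ Y → π₁ X ≈ₘ π₁ Y
  ≈ₘ-π₁ p i j = proj₂ (p i j)

  Σ-π₀ : ∀ {m} (f : Fin m → Carrier × Carrier) → proj₁ (D.Σ[ f ]) ≈ Σ[ (λ i → proj₁ (f i)) ]
  Σ-π₀ {zero}  f = refl
  Σ-π₀ {suc m} f = +-cong refl (Σ-π₀ (λ i → f (suc i)))

  Σ-π₁ : ∀ {m} (f : Fin m → Carrier × Carrier) → proj₂ (D.Σ[ f ]) ≈ Σ[ (λ i → proj₂ (f i)) ]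
  Σ-π₁ {zero}  f = refl
  Σ-π₁ {suc m} f = +-cong refl (Σ-π₁ (λ i → f (suc i)))

  ⟨⟩-π₀ : ∀ l v → proj₁ (D.⟨ l , v ⟩) ≈ ⟨ v₀ l , v₀ v ⟩
  ⟨⟩-π₀ l v = Σ-π₀ {n} _

  ⟨⟩-π₁ : ∀ l v → proj₂ (D.⟨ l , v ⟩) ≈ ⟨ v₀ l , v₁ v ⟩ + ⟨ v₁ l , v₀ v ⟩
  ⟨⟩-π₁ l v = trans (Σ-π₁ {n} _) (Σ-distrib-+ {n} _ _)

  ⊗-π₀ : ∀ X Y → π₀ (X D.⊗ Y) ≈ₘ (π₀ X ⊗ π₀ Y)
  ⊗-π₀ X Y i j = ⟨⟩-π₀ (X i) (λ k → Y k j)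

  ⊗-π₁ : ∀ X Y → π₁ (X D.⊗ Y) ≈ₘ ((π₀ X ⊗ π₁ Y) +ₘ (π₁ X ⊗ π₀ Y))
  ⊗-π₁ X Y i j = ⟨⟩-π₁ (X i) (λ k → Y k j)

  ·ᵥ-π₀ : ∀ X v → v₀ (X D.·ᵥ v) ≈ᵥ (π₀ X ·ᵥ v₀ v)
  ·ᵥ-π₀ X v i = ⟨⟩-π₀ (X i) v

  ·ᵥ-π₁ : ∀ X v → v₁ (X D.·ᵥ v) ≈ᵥ ((π₀ X ·ᵥ v₁ v) +ᵥ (π₁ X ·ᵥ v₀ v))
  ·ᵥ-π₁ X v i = ⟨⟩-π₁ (X i) v

  idM-π₀ : π₀ D.idM ≈ₘ idM
  idM-π₀ i j with Data.Fin._≟_ i j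
  ... | yes _ = refl
  ... | no  _ = refl

  idM-π₁ : π₁ D.idM ≈ₘ 0ₘ
  idM-π₁ i j with Data.Fin._≟_ i j
  ... | yes _ = refl
  ... | no  _ = refl

  fromℕ-π₀ : ∀ k → proj₁ (D.fromℕ k) ≈ fromℕ k
  fromℕ-π₀ zero    = refl
  fromℕ-π₀ (suc k) = +-cong refl (fromℕ-π₀ k)

  fromℕ-π₁ : ∀ k → proj₂ (D.fromℕ k) ≈ 0#
  fromℕ-π₁ zero    = refl
  fromℕ-π₁ (suc k) = trans (+-identityˡ _) (fromℕ-π₁ k)

  fromℤ-π₀ : ∀ z → proj₁ (D.fromℤ z) ≈ fromℤ z
  fromℤ-π₀ (ℤ.+ k)    = fromℕ-π₀ k
  fromℤ-π₀ ℤ.-[1+ k ] = -‿cong (fromℕ-π₀ (suc k))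

  fromℤ-π₁ : ∀ z → proj₂ (D.fromℤ z) ≈ 0#
  fromℤ-π₁ (ℤ.+ k)    = fromℕ-π₁ k
  fromℤ-π₁ ℤ.-[1+ k ] = trans (-‿cong (fromℕ-π₁ (suc k))) ε⁻¹≈ε

  eR-π₀ : v₀ D.eR ≈ᵥ eR
  eR-π₀ i = fromℤ-π₀ (e i)

  eR-π₁ : v₁ D.eR ≈ᵥ 0ᵥ
  eR-π₁ i = fromℤ-π₁ (e i)

  e*R-π₀ : v₀ D.e*R ≈ᵥ e*R
  e*R-π₀ i = fromℤ-π₀ (e* i)

  e*R-π₁ : v₁ D.e*R ≈ᵥ 0ᵥ
  e*R-π₁ i = fromℤ-π₁ (e* i)

  +-zeros : ∀ {x y} → x ≈ 0# → y ≈ 0# → x + y ≈ 0#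
  +-zeros x≈0 y≈0 = trans (+-cong x≈0 y≈0) (+-identityʳ 0#)

  ⊗-real-π₁ : ∀ {X Y} → π₁ X ≈ₘ 0ₘ → π₁ Y ≈ₘ 0ₘ → π₁ (X D.⊗ Y) ≈ₘ 0ₘ
  ⊗-real-π₁ {X} {Y} X₁≈0 Y₁≈0 i j = trans (⊗-π₁ X Y i j)
    (+-zeros (transₘ (⊗-cong reflₘ Y₁≈0) (⊗-zeroʳ (π₀ X)) i j) (transₘ (⊗-cong X₁≈0 reflₘ) (⊗-zeroˡ (π₀ Y)) i j))

  ⊗-real-π₀ : ∀ {X Y X' Y'} → π₀ X ≈ₘ X' → π₀ Y ≈ₘ Y' → π₀ (X D.⊗ Y) ≈ₘ (X' ⊗ Y')
  ⊗-real-π₀ {X} {Y} X₀≈ Y₀≈ = transₘ (⊗-π₀ X Y) (⊗-cong X₀≈ Y₀≈)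

  1H-π₀ : π₀ D.1H ≈ₘ 1H
  1H-π₀ i j = +-cong (idM-π₀ i j) (-‿cong (*-cong (eR-π₀ i) (e*R-π₀ j)))

  1H-π₁ : π₁ D.1H ≈ₘ 0ₘ
  1H-π₁ i j = trans (+-cong (idM-π₁ i j) (-‿cong outer₁≈0)) (trans (+-identityˡ _) ε⁻¹≈ε)
    where
    outer₁≈0 : proj₁ (D.eR i) * proj₂ (D.e*R j) + proj₂ (D.eR i) * proj₁ (D.e*R j) ≈ 0#
    outer₁≈0 = +-zeros (trans (*-cong refl (e*R-π₁ j)) (zeroʳ _)) (trans (*-cong (eR-π₁ i) refl) (zeroˡ _))

  base-H-π₀ : ∀ τ → π₀ (base τ D.H) ≈ₘ (τ H)
  base-H-π₀ τ = ⊗-real-π₀ 1H-π₀ (⊗-real-π₀ reflₘ 1H-π₀)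

  base-H-π₁ : ∀ τ → π₁ (base τ D.H) ≈ₘ 0ₘ
  base-H-π₁ τ = ⊗-real-π₁ 1H-π₁ (⊗-real-π₁ (λ _ _ → refl) 1H-π₁)

  ≈ᵥ-+ε : ∀ {v w} → v₀ v ≈ᵥ v₀ w → v₁ v ≈ᵥ v₁ w → v D.≈ᵥ w
  ≈ᵥ-+ε p q i = p i , q i

  e*R-pairing-π₀ : ∀ v → proj₁ (D.⟨ D.e*R , v ⟩) ≈ ⟨ e*R , v₀ v ⟩
  e*R-pairing-π₀ v = trans (⟨⟩-π₀ D.e*R v) (⟨⟩-cong e*R-π₀ reflᵥ)

  e*R-pairing-π₁ : ∀ v → proj₂ (D.⟨ D.e*R , v ⟩) ≈ ⟨ e*R , v₁ v ⟩
  e*R-pairing-π₁ v = trans (⟨⟩-π₁ D.e*R v)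
    (trans (+-cong (⟨⟩-cong e*R-π₀ reflᵥ) (trans (⟨⟩-cong e*R-π₁ reflᵥ) (⟨⟩-0ˡ _))) (+-identityʳ _))

  D-InVH⇒InVH : ∀ {v} → D.InVH v → InVH (v₀ v) × InVH (v₁ v)
  D-InVH⇒InVH {v} (v∈₀ , v∈₁) = trans (sym (e*R-pairing-π₀ v)) v∈₀ , trans (sym (e*R-pairing-π₁ v)) v∈₁

  InVH⇒D-InVH : ∀ {v} → InVH (v₀ v) → InVH (v₁ v) → D.InVH v
  InVH⇒D-InVH {v} v₀∈ v₁∈ = trans (e*R-pairing-π₀ v) v₀∈ , trans (e*R-pairing-π₁ v) v₁∈

  D-InH⇒π₀-fixes-e : ∀ {y} → D.InH y → (π₀ y ·ᵥ eR) ≈ᵥ eR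
  D-InH⇒π₀-fixes-e {y} (ye≈e , _) i =
    trans (sym (trans (·ᵥ-π₀ y D.eR i) (·ᵥ-cong (reflₘ {π₀ y}) eR-π₀ i))) (trans (proj₁ (ye≈e i)) (eR-π₀ i))

  D-InH⇒InMH-π₁ : ∀ {y} → D.InH y → InMH (π₁ y)
  D-InH⇒InMH-π₁ {y} (ye≈e , y-VH) = ue≈0 , u-VH
    where
    u = π₁ y
    ·ᵥ-π₁-real : ∀ v → v₁ v ≈ᵥ 0ᵥ → v₁ (y D.·ᵥ v) ≈ᵥ (u ·ᵥ v₀ v)
    ·ᵥ-π₁-real v v₁≈0 i = trans (·ᵥ-π₁ y v i)
      (trans (+-cong (transᵥ (·ᵥ-cong (reflₘ {π₀ y}) v₁≈0) (·ᵥ-zeroʳ (π₀ y)) i) refl) (+-identityˡ _))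
    ue≈0 : (u ·ᵥ eR) ≈ᵥ 0ᵥ
    ue≈0 i = trans (·ᵥ-cong (reflₘ {u}) (symᵥ eR-π₀) i)
               (trans (sym (·ᵥ-π₁-real D.eR eR-π₁ i)) (trans (proj₂ (ye≈e i)) (eR-π₁ i)))
    u-VH : ∀ v → InVH v → InVH (u ·ᵥ v)
    u-VH v v∈ = trans (⟨⟩-cong reflᵥ (symᵥ (·ᵥ-π₁-real (lift v) (λ _ → refl))))
                      (proj₂ (D-InVH⇒InVH (y-VH (lift v) (InVH⇒D-InVH v∈ (⟨⟩-0ʳ e*R)))))

  InMH⇒D-InH-1+ε : ∀ {u} → InMH u → D.InH (idM +ε u)
  InMH⇒D-InH-1+ε {u} (ue≈0 , u-VH) = fixes-e , preserves-VH
    where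
    y = idM +ε u
    fixes-e : (y D.·ᵥ D.eR) D.≈ᵥ D.eR
    fixes-e = ≈ᵥ-+ε (transᵥ (·ᵥ-π₀ y D.eR) (·ᵥ-identity _))
      (λ i → trans (·ᵥ-π₁ y D.eR i)
        (trans (+-cong (transᵥ (·ᵥ-identity _) eR-π₁ i) (transᵥ (·ᵥ-cong (reflₘ {u}) eR-π₀) ue≈0 i))
               (trans (+-identityˡ 0#) (sym (eR-π₁ i)))))
    preserves-VH : ∀ v → D.InVH v → D.InVH (y D.·ᵥ v)
    preserves-VH v v∈ = InVH⇒D-InVH
      (trans (⟨⟩-cong reflᵥ (transᵥ (·ᵥ-π₀ y v) (·ᵥ-identity _))) (proj₁ v∈'))
      (trans (⟨⟩-cong reflᵥ (·ᵥ-π₁ y v))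
        (trans (⟨⟩-+ʳ e*R _ _) (+-zeros (trans (⟨⟩-cong reflᵥ (·ᵥ-identity _)) (proj₂ v∈'))
                                        (u-VH (v₀ v) (proj₁ v∈')))))
      where
      v∈' = D-InVH⇒InVH v∈

  ⊗-π₁-realʳ : ∀ X {Y} → π₁ Y ≈ₘ 0ₘ → π₁ (X D.⊗ Y) ≈ₘ (π₁ X ⊗ π₀ Y)
  ⊗-π₁-realʳ X {Y} Y₁≈0 i j = trans (⊗-π₁ X Y i j)
    (trans (+-cong (transₘ (⊗-cong (reflₘ {π₀ X}) Y₁≈0) (⊗-zeroʳ (π₀ X)) i j) refl) (+-identityˡ _))

  ⊗-π₁-realˡ : ∀ {Y} X → π₁ Y ≈ₘ 0ₘ → π₁ (Y D.⊗ X) ≈ₘ (π₀ Y ⊗ π₁ X)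
  ⊗-π₁-realˡ {Y} X Y₁≈0 i j = trans (⊗-π₁ Y X i j)
    (trans (+-cong refl (transₘ (⊗-cong Y₁≈0 (reflₘ {π₀ X})) (⊗-zeroˡ (π₀ X)) i j)) (+-identityʳ _))

  D-Commute⇒Commute : ∀ {X Y} → π₁ Y ≈ₘ 0ₘ → D.Commute X Y →
    Commute (π₀ X) (π₀ Y) × Commute (π₁ X) (π₀ Y)
  D-Commute⇒Commute {X} {Y} Y₁≈0 XY =
    transₘ (symₘ (⊗-π₀ X Y)) (transₘ (≈ₘ-π₀ XY) (⊗-π₀ Y X)) ,
    transₘ (symₘ (⊗-π₁-realʳ X Y₁≈0)) (transₘ (≈ₘ-π₁ XY) (⊗-π₁-realˡ X Y₁≈0))

  Commute⇒D-Commute : ∀ {X Y} → π₁ Y ≈ₘ 0ₘ → Commute (π₀ X) (π₀ Y) → Commute (π₁ X) (π₀ Y) →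
    D.Commute X Y
  Commute⇒D-Commute {X} {Y} Y₁≈0 X₀Y₀ X₁Y₀ = ≈ₘ-+ε
    (transₘ (⊗-π₀ X Y) (transₘ X₀Y₀ (symₘ (⊗-π₀ Y X))))
    (transₘ (⊗-π₁-realʳ X Y₁≈0) (transₘ X₁Y₀ (symₘ (⊗-π₁-realˡ X Y₁≈0))))

  +ε-IsInv : ∀ {x y x' y'} → (x ⊗ x') ≈ₘ idM → (x' ⊗ x) ≈ₘ idM →
    ((x ⊗ y') +ₘ (y ⊗ x')) ≈ₘ 0ₘ → ((x' ⊗ y) +ₘ (y' ⊗ x)) ≈ₘ 0ₘ → D.IsInv (x +ε y) (x' +ε y')
  +ε-IsInv {x} {y} {x'} {y'} xx' x'x xy'+yx' x'y+y'x =
    ≈ₘ-+ε (transₘ (⊗-π₀ (x +ε y) (x' +ε y')) (transₘ xx' (symₘ idM-π₀)))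
          (transₘ (⊗-π₁ (x +ε y) (x' +ε y')) (transₘ xy'+yx' (symₘ idM-π₁))) ,
    ≈ₘ-+ε (transₘ (⊗-π₀ (x' +ε y') (x +ε y)) (transₘ x'x (symₘ idM-π₀)))
          (transₘ (⊗-π₁ (x' +ε y') (x +ε y)) (transₘ x'y+y'x (symₘ idM-π₁)))

  1+ε-IsInv : ∀ u → D.IsInv (idM +ε u) (idM +ε (0ₘ -ₘ u))
  1+ε-IsInv u = +ε-IsInv (⊗-identityˡ idM) (⊗-identityˡ idM)
    (transₘ (+ₘ-cong (⊗-identityˡ _) (⊗-identityʳ u)) (+ₘ-inverseˡ reflₘ))
    (transₘ (+ₘ-cong (⊗-identityˡ u) (⊗-identityʳ _)) (+ₘ-inverseʳ reflₘ))

  [1+εm]x-IsInv : ∀ {x x'} → IsInv x x' → ∀ m → D.IsInv (x +ε (m ⊗ x)) (x' +ε (0ₘ -ₘ (x' ⊗ m)))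
  [1+εm]x-IsInv {x} {x'} (xx' , x'x) m = +ε-IsInv xx' x'x
    (transₘ (+ₘ-cong (⊗-negʳ x (x' ⊗ m)) (transₘ (⊗-assoc m x x') (transₘ (⊗-cong reflₘ xx') (⊗-identityʳ m))))
            (+ₘ-inverseˡ (transₘ (symₘ (⊗-assoc x x' m)) (transₘ (⊗-cong xx' reflₘ) (⊗-identityˡ m)))))
    (transₘ (+ₘ-cong (symₘ (⊗-assoc x' m x)) (⊗-negˡ x (x' ⊗ m))) (+ₘ-inverseʳ reflₘ))

module Tangent {c ℓ} (R : CommutativeRing c ℓ) (n : ℕ) (e e* : Fin n → ℤ) where
  open DualNumbers R n e e* public

  module TangentSpace (e*e≈1 : ⟨ e*R , eR ⟩ ≈ 1#) (τ : Mat) (stab : Stable τ)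
                      (a a⁻¹ : Mat) (inv : IsInv a a⁻¹) (aτ : Commute a τ) where
    open StableEndomorphism e*e≈1 τ stab
    open Conjugation a a⁻¹ inv aτ

    Mτ+MH⇒represents : ∀ {w k h} → Commute k τ → InMH h → w ≈ₘ (k +ₘ h) → Represents k w
    Mτ+MH⇒represents {w} {k} {h} kτ h∈@(he≈0 , _) w≈k+h =
      kτ ,
      symᵥ (transᵥ (·ᵥ-cong w≈k+h reflᵥ) (transᵥ (·ᵥ-distribʳ-+ₘ k h eR)
                   (λ i → trans (+-cong refl (he≈0 i)) (+-identityʳ _)))) ,
      symᵥ (transᵥ (ᵥ·-cong reflᵥ w≈k+h) (transᵥ (ᵥ·-distribˡ-+ₘ e*R k h)
                   (λ j → trans (+-cong refl (InMH⇒e*-annihilates h∈ j)) (+-identityʳ _))))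

    represents⇒InMH-difference : ∀ {k w} → Represents k w → InMH (w -ₘ k)
    represents⇒InMH-difference {k} {w} (_ , ke≈we , e*k≈e*w) =
      (λ i → trans (·ᵥ-distribʳ--ₘ w k eR i) (x≈y⇒x∙y⁻¹≈ε (sym (ke≈we i)))) ,
      (λ v _ → e*-annihilates⇒preserves-VH
                 (λ j → trans (ᵥ·-distribˡ--ₘ e*R w k j) (x≈y⇒x∙y⁻¹≈ε (sym (e*k≈e*w j)))) v)


    -- h₀⁻¹ = g₀ a⁻¹ lies in M_τ and fixes e, hence is 1.
    factor-in-H-trivial : ∀ {h₀ c' g₀} → (h₀ ⊗ c') ≈ₘ idM → (c' ⊗ h₀) ≈ₘ idM → (h₀ ·ᵥ eR) ≈ᵥ eR →
      Commute g₀ τ → a ≈ₘ (h₀ ⊗ g₀) → (h₀ ≈ₘ idM) × (g₀ ≈ₘ a)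
    factor-in-H-trivial {h₀} {c'} {g₀} h₀c' c'h₀ h₀e≈e g₀τ a≈h₀g₀ = h₀≈1 , g₀≈a
      where
      c'≈g₀a⁻¹ : c' ≈ₘ (g₀ ⊗ a⁻¹)
      c'≈g₀a⁻¹ = begin
        c'                       ≈⟨ ⊗-identityʳ c' ⟨
        c' ⊗ idM                 ≈⟨ ⊗-cong reflₘ (proj₁ inv) ⟨
        c' ⊗ (a ⊗ a⁻¹)           ≈⟨ ⊗-cong reflₘ (⊗-cong a≈h₀g₀ reflₘ) ⟩
        c' ⊗ ((h₀ ⊗ g₀) ⊗ a⁻¹)   ≈⟨ ⊗-cong reflₘ (⊗-assoc h₀ g₀ a⁻¹) ⟩
        c' ⊗ (h₀ ⊗ (g₀ ⊗ a⁻¹))   ≈⟨ ⊗-assoc c' h₀ _ ⟨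
        (c' ⊗ h₀) ⊗ (g₀ ⊗ a⁻¹)   ≈⟨ ⊗-cong c'h₀ reflₘ ⟩
        idM ⊗ (g₀ ⊗ a⁻¹)         ≈⟨ ⊗-identityˡ _ ⟩
        g₀ ⊗ a⁻¹                 ∎
        where open ≈ₘ-Reasoning
      c'≈1 : c' ≈ₘ idM
      c'≈1 = Mτ-determined-by-·e c'τ (symₘ (comm-identity τ))
               (transᵥ (·ᵥ-cong reflₘ (symᵥ h₀e≈e)) (transᵥ (symᵥ (·ᵥ-assoc c' h₀ eR)) (·ᵥ-cong c'h₀ reflᵥ)))
        where
        c'τ : Commute c' τ
        c'τ = transₘ (⊗-cong c'≈g₀a⁻¹ reflₘ) (transₘ (Mτ-⊗ g₀τ a⁻¹τ) (⊗-cong reflₘ (symₘ c'≈g₀a⁻¹)))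
      h₀≈1 : h₀ ≈ₘ idM
      h₀≈1 = transₘ (symₘ (⊗-identityʳ h₀)) (transₘ (⊗-cong reflₘ (symₘ c'≈1)) h₀c')
      g₀≈a : g₀ ≈ₘ a
      g₀≈a = transₘ (symₘ (⊗-identityˡ g₀)) (transₘ (⊗-cong (symₘ h₀≈1) reflₘ) (symₘ a≈h₀g₀))

    W⊗a : ∀ u → (W u ⊗ a) ≈ₘ (a ⊗ u)
    W⊗a u = transₘ (⊗-assoc a (u ⊗ a⁻¹) a)
              (⊗-cong reflₘ (transₘ (⊗-assoc u a⁻¹ a) (transₘ (⊗-cong reflₘ (proj₂ inv)) (⊗-identityʳ u))))

    tangent-factorisation⇒represented : ∀ {u h₀ c' h₁ g₀ g₁} →
      (h₀ ⊗ c') ≈ₘ idM → (c' ⊗ h₀) ≈ₘ idM → (h₀ ·ᵥ eR) ≈ᵥ eR → InMH h₁ →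
      Commute g₀ τ → Commute g₁ τ →
      a ≈ₘ (h₀ ⊗ g₀) → (a ⊗ u) ≈ₘ ((h₀ ⊗ g₁) +ₘ (h₁ ⊗ g₀)) → Represents (g₁ ⊗ a⁻¹) (W u)
    tangent-factorisation⇒represented {u} {h₀} {c'} {h₁} {g₀} {g₁}
      h₀c' c'h₀ h₀e≈e h₁∈ g₀τ g₁τ a≈h₀g₀ au≈ =
      Mτ+MH⇒represents (Mτ-⊗ g₁τ a⁻¹τ) h₁∈ (begin
        a ⊗ (u ⊗ a⁻¹)                       ≈⟨ ⊗-assoc a u a⁻¹ ⟨
        (a ⊗ u) ⊗ a⁻¹                       ≈⟨ ⊗-cong au≈ reflₘ ⟩
        ((h₀ ⊗ g₁) +ₘ (h₁ ⊗ g₀)) ⊗ a⁻¹      ≈⟨ ⊗-cong (+ₘ-cong (transₘ (⊗-cong h₀≈1 reflₘ) (⊗-identityˡ g₁))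
                                                               (⊗-cong reflₘ g₀≈a)) reflₘ ⟩
        (g₁ +ₘ (h₁ ⊗ a)) ⊗ a⁻¹              ≈⟨ ⊗-distribʳ-+ₘ a⁻¹ g₁ _ ⟩
        (g₁ ⊗ a⁻¹) +ₘ ((h₁ ⊗ a) ⊗ a⁻¹)      ≈⟨ +ₘ-cong reflₘ (transₘ (⊗-assoc h₁ a a⁻¹)
                                                 (transₘ (⊗-cong reflₘ (proj₁ inv)) (⊗-identityʳ h₁))) ⟩
        (g₁ ⊗ a⁻¹) +ₘ h₁                    ∎)
      where
      open ≈ₘ-Reasoning
      trivial = factor-in-H-trivial h₀c' c'h₀ h₀e≈e g₀τ a≈h₀g₀
      h₀≈1 = proj₁ trivial
      g₀≈a = proj₂ trivial

    tangential⇒μ≡ν : Setup.Tangential1 R n e e* τ a → Setup.μ≡ν R n e e* τ a a⁻¹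
    tangential⇒μ≡ν tangential u u∈ uτH = represented⇒μ≡ν-at
      (tangent-factorisation⇒represented h₀c' c'h₀ (D-InH⇒π₀-fixes-e h∈) (D-InH⇒InMH-π₁ h∈)
         (proj₁ gτ') (proj₂ gτ') a≈h₀g₀ au≈h₀g₁+h₁g₀)
      where
      y = idM +ε u
      y∈ : D.InHτH (base τ) y (idM +ε (0ₘ -ₘ u))
      y∈ = 1+ε-IsInv u , InMH⇒D-InH-1+ε u∈ ,
           Commute⇒D-Commute (base-H-π₁ τ) (symₘ (comm-identity _)) (comm-respʳ (symₘ (base-H-π₀ τ)) uτH)
      factorisation = proj₂ (tangential y _ y∈ (λ _ _ → refl))
      h = proj₁ factorisation
      h⁻¹ = proj₁ (proj₂ factorisation)
      g = proj₁ (proj₂ (proj₂ factorisation))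
      h-inv = proj₁ (proj₁ (proj₂ (proj₂ (proj₂ (proj₂ factorisation)))))
      h∈ = proj₂ (proj₁ (proj₂ (proj₂ (proj₂ (proj₂ factorisation)))))
      gτ = proj₂ (proj₁ (proj₂ (proj₂ (proj₂ (proj₂ (proj₂ factorisation))))))
      ay≈hg = proj₂ (proj₂ (proj₂ (proj₂ (proj₂ (proj₂ factorisation)))))
      gτ' = D-Commute⇒Commute {g} {base τ} (λ _ _ → refl) gτ
      h₀c' : (π₀ h ⊗ π₀ h⁻¹) ≈ₘ idM
      h₀c' = transₘ (symₘ (⊗-π₀ h h⁻¹)) (transₘ (≈ₘ-π₀ (proj₁ h-inv)) idM-π₀)
      c'h₀ : (π₀ h⁻¹ ⊗ π₀ h) ≈ₘ idM
      c'h₀ = transₘ (symₘ (⊗-π₀ h⁻¹ h)) (transₘ (≈ₘ-π₀ (proj₂ h-inv)) idM-π₀)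
      a≈h₀g₀ : a ≈ₘ (π₀ h ⊗ π₀ g)
      a≈h₀g₀ = transₘ (symₘ (⊗-identityʳ a)) (transₘ (symₘ (⊗-π₀ (base a) y))
                 (transₘ (≈ₘ-π₀ ay≈hg) (⊗-π₀ h g)))
      au≈h₀g₁+h₁g₀ : (a ⊗ u) ≈ₘ ((π₀ h ⊗ π₁ g) +ₘ (π₁ h ⊗ π₀ g))
      au≈h₀g₁+h₁g₀ = transₘ (symₘ (⊗-π₁-realˡ y (λ _ _ → refl)))
                       (transₘ (≈ₘ-π₁ ay≈hg) (⊗-π₁ h g))

    μ≡ν⇒tangential : Setup.μ≡ν R n e e* τ a a⁻¹ → Setup.Tangential1 R n e e* τ a
    μ≡ν⇒tangential μ≡ν y y⁻¹ y∈@(_ , y∈H , yτH) y₀≈1 =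
      y∈ , h , h⁻¹ , g , g⁻¹ , (1+ε-IsInv d , InMH⇒D-InH-1+ε d∈) ,
      ([1+εm]x-IsInv inv k , Commute⇒D-Commute (λ _ _ → refl) aτ (Mτ-⊗ kτ aτ)) ,
      ay≈hg
      where
      u = π₁ y
      u∈ = D-InH⇒InMH-π₁ y∈H
      uτH : Commute u (τ H)
      uτH = comm-respʳ (base-H-π₀ τ) (proj₂ (D-Commute⇒Commute (base-H-π₁ τ) yτH))
      k-rep = μ≡ν-at⇒represented (μ≡ν u u∈ uτH)
      k = proj₁ k-rep
      kτ = proj₁ (proj₂ k-rep)
      d = W u -ₘ k
      d∈ = represents⇒InMH-difference (proj₂ k-rep)
      h = idM +ε d
      h⁻¹ = idM +ε (0ₘ -ₘ d)
      g = a +ε (k ⊗ a)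
      g⁻¹ = a⁻¹ +ε (0ₘ -ₘ (a⁻¹ ⊗ k))
      hg₁≈au : ((idM ⊗ (k ⊗ a)) +ₘ (d ⊗ a)) ≈ₘ (a ⊗ u)
      hg₁≈au = begin
        (idM ⊗ (k ⊗ a)) +ₘ (d ⊗ a)              ≈⟨ +ₘ-cong (⊗-identityˡ _) (⊗-distribʳ--ₘ a (W u) k) ⟩
        (k ⊗ a) +ₘ ((W u ⊗ a) -ₘ (k ⊗ a))       ≈⟨ (λ i j → trans (+-comm _ _) (trans (+-assoc _ _ _)
                                                      (trans (+-cong refl (-‿inverseˡ _)) (+-identityʳ _)))) ⟩
        W u ⊗ a                                 ≈⟨ W⊗a u ⟩
        a ⊗ u                                   ∎
        where open ≈ₘ-Reasoning
      ay≈hg : (base a D.⊗ y) D.≈ₘ (h D.⊗ g)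
      ay≈hg = ≈ₘ-+ε eq₀ eq₁
        where
        eq₀ : π₀ (base a D.⊗ y) ≈ₘ π₀ (h D.⊗ g)
        eq₀ = transₘ (⊗-π₀ (base a) y) (transₘ (⊗-cong reflₘ y₀≈1)
               (transₘ (⊗-identityʳ a) (transₘ (symₘ (⊗-identityˡ a)) (symₘ (⊗-π₀ h g)))))
        eq₁ : π₁ (base a D.⊗ y) ≈ₘ π₁ (h D.⊗ g)
        eq₁ = transₘ (⊗-π₁-realˡ y (λ _ _ → refl)) (symₘ (transₘ (⊗-π₁ h g) hg₁≈au))

module IntegerCast {c ℓ} (R : CommutativeRing c ℓ) (n : ℕ) (e e* : Fin n → ℤ) where
  open Matrices R n e e*
  open CommutativeRing R using (semiring; *-commutativeSemigroup)
  open CommSemigroupProperties *-commutativeSemigroup using () renaming (interchange to *-interchange)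
  open SemiringMultProperties semiring using (×-homo-+; ×1-homo-*) renaming (_×_ to _×ℕ_)

  ≡⇒≈ : ∀ {x y} → x ≡ y → x ≈ y
  ≡⇒≈ P.refl = refl

  fromℕ≈×1# : ∀ k → fromℕ k ≈ k ×ℕ 1#
  fromℕ≈×1# zero    = refl
  fromℕ≈×1# (suc k) = +-cong refl (fromℕ≈×1# k)

  fromℕ-+ : ∀ m k → fromℕ (m ℕ.+ k) ≈ fromℕ m + fromℕ k
  fromℕ-+ m k = trans (fromℕ≈×1# (m ℕ.+ k))
    (trans (×-homo-+ 1# m k) (sym (+-cong (fromℕ≈×1# m) (fromℕ≈×1# k))))

  fromℕ-* : ∀ m k → fromℕ (m ℕ.* k) ≈ fromℕ m * fromℕ k
  fromℕ-* m k = trans (fromℕ≈×1# (m ℕ.* k))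
    (trans (×1-homo-* m k) (sym (*-cong (fromℕ≈×1# m) (fromℕ≈×1# k))))

  fromℤ-⊖ : ∀ m k → fromℤ (m ℤ.⊖ k) ≈ fromℕ m + - fromℕ k
  fromℤ-⊖ m       zero    = sym (trans (+-cong refl ε⁻¹≈ε) (+-identityʳ _))
  fromℤ-⊖ zero    (suc k) = sym (+-identityˡ _)
  fromℤ-⊖ (suc m) (suc k) rewrite ℤProperties.[1+m]⊖[1+n]≡m⊖n m k = begin
    fromℤ (m ℤ.⊖ k)                          ≈⟨ fromℤ-⊖ m k ⟩
    fromℕ m + - fromℕ k                      ≈⟨ +-identityˡ _ ⟨
    0# + (fromℕ m + - fromℕ k)               ≈⟨ +-cong (-‿inverseʳ 1#) refl ⟨
    (1# + - 1#) + (fromℕ m + - fromℕ k)      ≈⟨ interchange _ _ _ _ ⟩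
    (1# + fromℕ m) + (- 1# + - fromℕ k)      ≈⟨ +-cong refl (⁻¹-∙-comm 1# (fromℕ k)) ⟩
    (1# + fromℕ m) + - (1# + fromℕ k)        ∎
    where open ≈-Reasoning

  fromℤ-+ : ∀ x y → fromℤ (x ℤ.+ y) ≈ fromℤ x + fromℤ y
  fromℤ-+ (ℤ.+ m)    (ℤ.+ k)    = fromℕ-+ m k
  fromℤ-+ (ℤ.+ m)    ℤ.-[1+ k ] = fromℤ-⊖ m (suc k)
  fromℤ-+ ℤ.-[1+ m ] (ℤ.+ k)    = trans (fromℤ-⊖ k (suc m)) (+-comm _ _)
  fromℤ-+ ℤ.-[1+ m ] ℤ.-[1+ k ] =
    trans (-‿cong (trans (≡⇒≈ (P.cong (λ t → fromℕ (suc t)) (P.sym (ℕProperties.+-suc m k))))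
                         (fromℕ-+ (suc m) (suc k))))
          (sym (⁻¹-∙-comm _ _))


  fromSign : Sign → Carrier
  fromSign Sign.+ = 1#
  fromSign Sign.- = - 1#

  fromSign-* : ∀ s t → fromSign (s Sign.* t) ≈ fromSign s * fromSign t
  fromSign-* Sign.+ Sign.+ = sym (*-identityˡ _)
  fromSign-* Sign.+ Sign.- = sym (*-identityˡ _)
  fromSign-* Sign.- Sign.+ = sym (*-identityʳ _)
  fromSign-* Sign.- Sign.- = sym (trans (-1*x≈-x (- 1#)) (-‿involutive 1#))

  fromℤ-◃ : ∀ s k → fromℤ (s ℤ.◃ k) ≈ fromSign s * fromℕ k
  fromℤ-◃ s      zero    = sym (zeroʳ _)
  fromℤ-◃ Sign.+ (suc k) = sym (*-identityˡ _)
  fromℤ-◃ Sign.- (suc k) = sym (-1*x≈-x _)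

  fromℤ≈sign*abs : ∀ z → fromℤ z ≈ fromSign (ℤ.sign z) * fromℕ ℤ.∣ z ∣
  fromℤ≈sign*abs z = trans (≡⇒≈ (P.cong fromℤ (P.sym (ℤProperties.◃-inverse z)))) (fromℤ-◃ (ℤ.sign z) ℤ.∣ z ∣)

  fromℤ-* : ∀ x y → fromℤ (x ℤ.* y) ≈ fromℤ x * fromℤ y
  fromℤ-* x y = begin
    fromℤ (s Sign.* t ℤ.◃ m ℕ.* k)                   ≈⟨ fromℤ-◃ (s Sign.* t) (m ℕ.* k) ⟩
    fromSign (s Sign.* t) * fromℕ (m ℕ.* k)          ≈⟨ *-cong (fromSign-* s t) (fromℕ-* m k) ⟩
    (fromSign s * fromSign t) * (fromℕ m * fromℕ k)  ≈⟨ *-interchange _ _ _ _ ⟩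
    (fromSign s * fromℕ m) * (fromSign t * fromℕ k)  ≈⟨ *-cong (fromℤ≈sign*abs x) (fromℤ≈sign*abs y) ⟨
    fromℤ x * fromℤ y                                ∎
    where
    open ≈-Reasoning
    s = ℤ.sign x
    t = ℤ.sign y
    m = ℤ.∣ x ∣
    k = ℤ.∣ y ∣

  fromℤ-sumℤ : ∀ {m} (f : Fin m → ℤ) → fromℤ (sumℤ f) ≈ Σ[ (λ i → fromℤ (f i)) ]
  fromℤ-sumℤ {zero}  f = refl
  fromℤ-sumℤ {suc m} f = trans (fromℤ-+ (f zero) _) (+-cong refl (fromℤ-sumℤ (λ i → f (suc i))))

  e*e≈1 : sumℤ (λ i → e* i ℤ.* e i) P.≡ ℤ.+ 1 → ⟨ e*R , eR ⟩ ≈ 1#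
  e*e≈1 e*e≡1 = begin
    ⟨ e*R , eR ⟩                               ≈⟨ Σ-cong (λ i → fromℤ-* (e* i) (e i)) ⟨
    Σ[ (λ i → fromℤ (e* i ℤ.* e i)) ]          ≈⟨ fromℤ-sumℤ (λ i → e* i ℤ.* e i) ⟨
    fromℤ (sumℤ (λ i → e* i ℤ.* e i))          ≡⟨ P.cong fromℤ e*e≡1 ⟩
    1# + 0#                                    ≈⟨ +-identityʳ 1# ⟩
    1#                                         ∎
    where open ≈-Reasoning

proposition5p12 : ∀ {c ℓ} (R : CommutativeRing c ℓ) (n : ℕ) (e e* : Fin n → ℤ) →
    sumℤ (λ i → e* i ℤ.* e i) ≡ + 1 →
    (τ a a⁻¹ : Setup.Mat R n e e*) →
    Setup.L.Stable R n e e* τ →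
    Setup.L.IsInv R n e e* a a⁻¹ →
    Setup.L.Commute R n e e* a τ →
    (Setup.Tangential1 R n e e* τ a ⇔ Setup.μ≡ν R n e e* τ a a⁻¹)
    × (Setup.μ≡ν R n e e* τ a a⁻¹ ⇔ Setup.AB R n e e* τ a a⁻¹)
    × (Setup.AB R n e e* τ a a⁻¹ ⇔ Setup.SqCentral R n e e* a)
proposition5p12 R n e e* e*e≡1 τ a a⁻¹ stab inv aτ =
  mk⇔ tangential⇒μ≡ν μ≡ν⇒tangential ,
  mk⇔ ii⇒iii (iv⇒ii ∘ iii⇒iv) ,
  mk⇔ iii⇒iv (ii⇒iii ∘ iv⇒ii)
  where
  open Tangent R n e e*
  open TangentSpace (IntegerCast.e*e≈1 R n e e* e*e≡1) τ stab a a⁻¹ inv aτ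
  open StableEndomorphism (IntegerCast.e*e≈1 R n e e* e*e≡1) τ stab
  open Conjugation a a⁻¹ inv aτ

  ii⇒iii : Setup.μ≡ν R n e e* τ a a⁻¹ → Setup.AB R n e e* τ a a⁻¹
  ii⇒iii μ≡ν = FromBalance.Aⱼa⁻¹≈Bⱼa (μ≡ν⇒W-balanced μ≡ν)

  iii⇒iv : Setup.AB R n e e* τ a a⁻¹ → Setup.SqCentral R n e e* a
  iii⇒iv ab = a⁻¹-scalar⇒a²-central (proj₂ (AB⇒a⁻¹-scalar ab))

  iv⇒ii : Setup.SqCentral R n e e* a → Setup.μ≡ν R n e e* τ a a⁻¹
  iv⇒ii a²-central = W-balanced⇒μ≡ν (a⁻¹-scalar⇒W-balanced (proj₂ (a²-central⇒a⁻¹-scalar a²-central)))
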